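{- Let $f = a_0 + a_1z +\cdots+a_m z^m\in \mathbb{Z}[z]$ be a primitive polynomial with $a_0a_m\neq 0$ and $m\geq 2$, such that $$|a_{m-1}|> 1+ |a_0||a_m|^{m-1}+|a_1||a_m|^{m-2}+\cdots+|a_{m-2}||a_m|.$$ Then $f$ is irreducible in $\mathbb{Z}[z]$.
   Context: A polynomial in $\mathbb{Z}[z]$ is primitive if the gcd of its coefficients is $1$. -}

module Defs where

open import Data.Nat as ℕ using (ℕ; zero; suc; _∸_; _^_)
open import Data.Integer as ℤ using (ℤ; +_; -[1+_]; ∣_∣)
open import Data.List using (List; []; _∷_; map; upTo)
open import Data.Nat.ListAction using (sum)
open import Data.Nat.Divisibility using (_∣_)
open import Data.Sum using (_⊎_)
open import Data.Product using (_×_)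
open import Relation.Nullary using (¬_)
open import Relation.Binary.PropositionalEquality using (_≡_)

-- Polynomials in ℤ[z] as coefficient lists, lowest degree first.
-- Two lists represent the same polynomial iff all their coefficients agree
-- (trailing zeros are irrelevant).
Poly : Set
Poly = List ℤ

coeff : Poly → ℕ → ℤ
coeff []      _       = + 0
coeff (a ∷ p) zero    = a
coeff (a ∷ p) (suc n) = coeff p n

infix 4 _≈P_
_≈P_ : Poly → Poly → Set
p ≈P q = ∀ n → coeff p n ≡ coeff q n

infixl 6 _+P_
_+P_ : Poly → Poly → Poly
[]      +P q       = q
(a ∷ p) +P []      = a ∷ p
(a ∷ p) +P (b ∷ q) = (a ℤ.+ b) ∷ (p +P q)

infixl 7 _*P_
_*P_ : Poly → Poly → Poly
[]      *P q = []
(a ∷ p) *P q = map (a ℤ.*_) q +P (+ 0 ∷ (p *P q))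

IsUnit : Poly → Set
IsUnit p = (p ≈P (+ 1 ∷ [])) ⊎ (p ≈P (-[1+ 0 ] ∷ []))

Irreducible : Poly → Set
Irreducible f = ¬ (f ≈P []) × ¬ IsUnit f ×
  (∀ g h → g *P h ≈P f → IsUnit g ⊎ IsUnit h)

polyOf : ℕ → (ℕ → ℤ) → Poly
polyOf m a = map a (upTo (suc m))

Primitive : ℕ → (ℕ → ℤ) → Set
Primitive m a = ∀ d → (∀ i → i ℕ.≤ m → d ∣ ∣ a i ∣) → d ≡ 1

boundSum : ℕ → (ℕ → ℤ) → ℕ
boundSum m a = sum (map (λ i → ∣ a i ∣ ℕ.* (∣ a m ∣ ^ (m ∸ 1 ∸ i))) (upTo (m ∸ 1)))

-- Put m = N + 1 and A = a_m. Then Aᴺ f (z / A) = z^{N+1} + a_N z^N + ∑_{i<N} bᵢ zⁱ with bᵢ = aᵢ A^{N-i} is a monic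
-- integer polynomial with |a_N| ≥ 2 + ∑ |bᵢ|. Instead of locating its roots we study the integer solutions of the
-- recurrence x_{s+N+1} + a_N x_{s+N} + ∑ bᵢ x_{s+i} = 0. Once the newest entry of a window of N + 1 consecutive
-- terms dominates the others it does so forever, and the solution grows geometrically; a second solution y then
-- becomes proportional to such an x, in that the wedges x_q y_p - y_q x_p shrink relative to x_p x_q. A solution
-- whose windows are never dominated stays bounded, so, being integral, it is eventually zero.
-- A factorisation f = g h into factors of positive degree rescales to A (z^{N+1} + ⋯) = P Q with integral P, Q of
-- degree ≤ N and nonzero constant terms. Apply P and Q, as polynomials in the shift, to the impulse solution c:
-- d = Q c and e = P c are again solutions, P d = 0, and the nonzero constant terms keep d and e from vanishing
-- eventually, so c, d and e all grow. Since d becomes proportional to c, P d = 0 makes e = P c negligible against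
-- c, while e, growing too, is comparable with c: a contradiction.

module Submission where

open import Defs
open import Function using (_∘_)
open import Data.Nat as ℕ using (ℕ; zero; suc; _≤_; _<_; z≤n; s≤s; _∸_; _^_; _+_; _*_; _⊔_; ⌈_/2⌉)
import Data.Nat.Properties as ℕₚ
open import Algebra.Properties.CommutativeSemigroup ℕₚ.*-commutativeSemigroup using (x∙yz≈y∙xz)
open import Data.Nat.Divisibility using (_∣_; divides)
open import Data.Nat.Induction using (<-rec)
open import Data.Nat.ListAction using (sum)
open import Data.Nat.Tactic.RingSolver using (solve-∀)
open import Data.Integer as ℤ using (ℤ; 0ℤ; 1ℤ; -1ℤ; ∣_∣)
import Data.Integer.Properties as ℤₚ
open import Algebra.Properties.AbelianGroup ℤₚ.+-0-abelianGroup using (inverseˡ-unique)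
open import Data.Integer.Tactic.RingSolver using (solve)
open import Data.List using ([]; _∷_; map; foldr; applyUpTo)
import Data.List.Properties as Listₚ
open import Data.Empty using (⊥; ⊥-elim)
open import Data.Product using (∃-syntax; _×_; _,_; proj₁; proj₂)
open import Data.Sum using (_⊎_; inj₁; inj₂; [_,_]′)
open import Relation.Nullary using (¬_; yes; no)
open import Relation.Binary.PropositionalEquality

sumℕ : ℕ → (ℕ → ℕ) → ℕ
sumℕ n f = sum (applyUpTo f n)

sumℤ : ℕ → (ℕ → ℤ) → ℤ
sumℤ n f = foldr ℤ._+_ 0ℤ (applyUpTo f n)

sumℕ-cong : ∀ n {f g} → (∀ i → i < n → f i ≡ g i) → sumℕ n f ≡ sumℕ n g
sumℕ-cong zero    eq = refl
sumℕ-cong (suc n) eq = cong₂ _+_ (eq 0 (s≤s z≤n)) (sumℕ-cong n (λ i i<n → eq (suc i) (s≤s i<n)))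

sumℕ-mono-≤ : ∀ n {f g} → (∀ i → i < n → f i ≤ g i) → sumℕ n f ≤ sumℕ n g
sumℕ-mono-≤ zero    le = z≤n
sumℕ-mono-≤ (suc n) le = ℕₚ.+-mono-≤ (le 0 (s≤s z≤n)) (sumℕ-mono-≤ n (λ i i<n → le (suc i) (s≤s i<n)))

sumℕ-*ˡ : ∀ n c f → sumℕ n (λ i → c * f i) ≡ c * sumℕ n f
sumℕ-*ˡ zero    c f = sym (ℕₚ.*-zeroʳ c)
sumℕ-*ˡ (suc n) c f = trans (cong (λ s → c * f 0 + s) (sumℕ-*ˡ n c (f ∘ suc))) (sym (ℕₚ.*-distribˡ-+ c (f 0) _))

sumℕ-*ʳ : ∀ n f c → sumℕ n (λ i → f i * c) ≡ sumℕ n f * c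
sumℕ-*ʳ n f c = trans (sumℕ-cong n (λ i _ → ℕₚ.*-comm (f i) c)) (trans (sumℕ-*ˡ n c f) (ℕₚ.*-comm c _))

term≤sumℕ : ∀ n f {i} → i < n → f i ≤ sumℕ n f
term≤sumℕ (suc n) f {zero}  _         = ℕₚ.m≤m+n (f 0) _
term≤sumℕ (suc n) f {suc i} (s≤s i<n) = ℕₚ.≤-trans (term≤sumℕ n (f ∘ suc) i<n) (ℕₚ.m≤n+m _ (f 0))

sumℤ-cong : ∀ n {f g} → (∀ i → i < n → f i ≡ g i) → sumℤ n f ≡ sumℤ n g
sumℤ-cong zero    eq = refl
sumℤ-cong (suc n) eq = cong₂ ℤ._+_ (eq 0 (s≤s z≤n)) (sumℤ-cong n (λ i i<n → eq (suc i) (s≤s i<n)))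

sumℤ-*ˡ : ∀ n c f → sumℤ n (λ i → c ℤ.* f i) ≡ c ℤ.* sumℤ n f
sumℤ-*ˡ zero    c f = sym (ℤₚ.*-zeroʳ c)
sumℤ-*ˡ (suc n) c f = trans (cong (λ s → c ℤ.* f 0 ℤ.+ s) (sumℤ-*ˡ n c (f ∘ suc))) (sym (ℤₚ.*-distribˡ-+ c (f 0) _))

sumℤ-sub : ∀ n f g → sumℤ n (λ i → f i ℤ.- g i) ≡ sumℤ n f ℤ.- sumℤ n g
sumℤ-sub zero    f g = refl
sumℤ-sub (suc n) f g = begin
  f 0 ℤ.- g 0 ℤ.+ sumℤ n (λ i → f (suc i) ℤ.- g (suc i)) ≡⟨ cong (λ s → f 0 ℤ.- g 0 ℤ.+ s) (sumℤ-sub n (f ∘ suc) (g ∘ suc)) ⟩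
  f 0 ℤ.- g 0 ℤ.+ (sumℤ n (f ∘ suc) ℤ.- sumℤ n (g ∘ suc))  ≡⟨ interchange (f 0) (g 0) _ _ ⟩
  f 0 ℤ.+ sumℤ n (f ∘ suc) ℤ.- (g 0 ℤ.+ sumℤ n (g ∘ suc))  ∎
  where
  open ≡-Reasoning
  interchange : ∀ a b c d → a ℤ.- b ℤ.+ (c ℤ.- d) ≡ a ℤ.+ c ℤ.- (b ℤ.+ d)
  interchange a b c d = solve (a ∷ b ∷ c ∷ d ∷ [])

sumℤ-snoc : ∀ n f → sumℤ (suc n) f ≡ sumℤ n f ℤ.+ f n
sumℤ-snoc zero    f = trans (ℤₚ.+-identityʳ (f 0)) (sym (ℤₚ.+-identityˡ (f 0)))
sumℤ-snoc (suc n) f = trans (cong (λ s → f 0 ℤ.+ s) (sumℤ-snoc n (f ∘ suc))) (sym (ℤₚ.+-assoc (f 0) _ _))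

∣sumℤ∣≤sumℕ∣∣ : ∀ n f → ∣ sumℤ n f ∣ ≤ sumℕ n (∣_∣ ∘ f)
∣sumℤ∣≤sumℕ∣∣ zero    f = z≤n
∣sumℤ∣≤sumℕ∣∣ (suc n) f =
  ℕₚ.≤-trans (ℤₚ.∣i+j∣≤∣i∣+∣j∣ (f 0) _) (ℕₚ.+-monoʳ-≤ ∣ f 0 ∣ (∣sumℤ∣≤sumℕ∣∣ n (f ∘ suc)))

i≢0⇒∣i∣≥1 : ∀ {i} → i ≢ 0ℤ → 1 ≤ ∣ i ∣
i≢0⇒∣i∣≥1 i≢0 = ℕₚ.n≢0⇒n>0 (i≢0 ∘ ℤₚ.∣i∣≡0⇒i≡0)

∣i∣≥1⇒i≢0 : ∀ {i} → 1 ≤ ∣ i ∣ → i ≢ 0ℤ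
∣i∣≥1⇒i≢0 1≤0 refl = ℕₚ.<-irrefl refl 1≤0

i*j≢0 : ∀ {i j} → i ≢ 0ℤ → j ≢ 0ℤ → i ℤ.* j ≢ 0ℤ
i*j≢0 {i} i≢0 j≢0 eq = [ i≢0 , j≢0 ]′ (ℤₚ.i*j≡0⇒i≡0∨j≡0 i eq)

i*j≢0⇒i≢0 : ∀ {i j} → i ℤ.* j ≢ 0ℤ → i ≢ 0ℤ
i*j≢0⇒i≢0 {i} {j} ij≢0 refl = ij≢0 refl

i*j≢0⇒j≢0 : ∀ {i j} → i ℤ.* j ≢ 0ℤ → j ≢ 0ℤ
i*j≢0⇒j≢0 {i} {j} ij≢0 refl = ij≢0 (ℤₚ.*-zeroʳ i)

∣i∣≡1⇒i≡±1 : ∀ i → ∣ i ∣ ≡ 1 → i ≡ 1ℤ ⊎ i ≡ -1ℤ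
∣i∣≡1⇒i≡±1 (ℤ.+ 1)     _ = inj₁ refl
∣i∣≡1⇒i≡±1 ℤ.-[1+ 0 ]  _ = inj₂ refl

∣i∣^n : ∀ i n → ∣ i ℤ.^ n ∣ ≡ ∣ i ∣ ^ n
∣i∣^n i zero    = refl
∣i∣^n i (suc n) = trans (ℤₚ.abs-* i (i ℤ.^ n)) (cong (∣ i ∣ *_) (∣i∣^n i n))

n≤2*⌈n/2⌉ : ∀ n → n ≤ 2 * ⌈ n /2⌉
n≤2*⌈n/2⌉ zero          = z≤n
n≤2*⌈n/2⌉ (suc zero)    = s≤s z≤n
n≤2*⌈n/2⌉ (suc (suc n)) = ℕₚ.≤-trans (s≤s (s≤s (n≤2*⌈n/2⌉ n))) (ℕₚ.≤-reflexive (sym (ℕₚ.*-suc 2 ⌈ n /2⌉)))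

2*⌈n/2⌉≤1+n : ∀ n → 2 * ⌈ n /2⌉ ≤ suc n
2*⌈n/2⌉≤1+n zero          = z≤n
2*⌈n/2⌉≤1+n (suc zero)    = s≤s (s≤s z≤n)
2*⌈n/2⌉≤1+n (suc (suc n)) = ℕₚ.≤-trans (ℕₚ.≤-reflexive (ℕₚ.*-suc 2 ⌈ n /2⌉)) (s≤s (s≤s (2*⌈n/2⌉≤1+n n)))

4*n≤[1+n]² : ∀ n → 4 * n ≤ suc n * suc n
4*n≤[1+n]² zero    = z≤n
4*n≤[1+n]² (suc n) = ℕₚ.≤-trans (ℕₚ.m≤m+n (4 * suc n) (n * n)) (ℕₚ.≤-reflexive (expand n))
  where
  expand : ∀ n → 4 * suc n + n * n ≡ suc (suc n) * suc (suc n)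
  expand = solve-∀

m+n+[o∸n]≡m+o : ∀ m {n o} → n ≤ o → m + n + (o ∸ n) ≡ m + o
m+n+[o∸n]≡m+o m {n} {o} n≤o = trans (ℕₚ.+-assoc m n (o ∸ n)) (cong (m +_) (ℕₚ.m+[n∸m]≡n n≤o))

from-shifted : ∀ {P : ℕ → Set} n s₀ → (∀ s → s₀ ≤ s → P (s + n)) → ∀ t → s₀ + n ≤ t → P t
from-shifted {P} n s₀ at t s₀+n≤t = subst P (ℕₚ.m∸n+n≡m n≤t) (at (t ∸ n) s₀≤t∸n)
  where
  n≤t : n ≤ t
  n≤t = ℕₚ.≤-trans (ℕₚ.m≤n+m n s₀) s₀+n≤t
  s₀≤t∸n : s₀ ≤ t ∸ n
  s₀≤t∸n = ℕₚ.+-cancelʳ-≤ n s₀ (t ∸ n) (ℕₚ.≤-trans s₀+n≤t (ℕₚ.≤-reflexive (sym (ℕₚ.m∸n+n≡m n≤t))))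

n<m^n : ∀ {m} → 2 ≤ m → ∀ n → n < m ^ n
n<m^n {m} 2≤m zero    = s≤s z≤n
n<m^n {m} 2≤m (suc n) = begin
  suc (suc n)       ≤⟨ ℕₚ.+-monoˡ-≤ (suc n) (s≤s (z≤n {n})) ⟩
  suc n + suc n     ≡⟨ cong (suc n +_) (sym (ℕₚ.+-identityʳ (suc n))) ⟩
  2 * suc n         ≤⟨ ℕₚ.*-mono-≤ 2≤m (n<m^n 2≤m n) ⟩
  m * m ^ n         ∎
  where open ℕₚ.≤-Reasoning

m*n≤m^n : ∀ {m} → 2 ≤ m → ∀ n → m * n ≤ m ^ n
m*n≤m^n {m} 2≤m zero    = ℕₚ.≤-trans (ℕₚ.≤-reflexive (ℕₚ.*-zeroʳ m)) z≤n
m*n≤m^n {m} 2≤m (suc n) = ℕₚ.*-monoʳ-≤ m (n<m^n 2≤m n)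

coeff-+P : ∀ p q n → coeff (p +P q) n ≡ coeff p n ℤ.+ coeff q n
coeff-+P []      q       n       = sym (ℤₚ.+-identityˡ _)
coeff-+P (a ∷ p) []      n       = sym (ℤₚ.+-identityʳ _)
coeff-+P (a ∷ p) (b ∷ q) zero    = refl
coeff-+P (a ∷ p) (b ∷ q) (suc n) = coeff-+P p q n

coeff-map-* : ∀ c q n → coeff (map (c ℤ.*_) q) n ≡ c ℤ.* coeff q n
coeff-map-* c []      n       = sym (ℤₚ.*-zeroʳ c)
coeff-map-* c (b ∷ q) zero    = refl
coeff-map-* c (b ∷ q) (suc n) = coeff-map-* c q n

coeff-*P-zero : ∀ p q → coeff (p *P q) 0 ≡ coeff p 0 ℤ.* coeff q 0
coeff-*P-zero []      q = refl
coeff-*P-zero (a ∷ p) q =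
  trans (coeff-+P (map (a ℤ.*_) q) (0ℤ ∷ (p *P q)) 0) (trans (ℤₚ.+-identityʳ _) (coeff-map-* a q 0))

coeff-∷*P-suc : ∀ a p q n → coeff ((a ∷ p) *P q) (suc n) ≡ a ℤ.* coeff q (suc n) ℤ.+ coeff (p *P q) n
coeff-∷*P-suc a p q n =
  trans (coeff-+P (map (a ℤ.*_) q) (0ℤ ∷ (p *P q)) (suc n)) (cong (ℤ._+ coeff (p *P q) n) (coeff-map-* a q (suc n)))

*P-zeroˡ : ∀ p q → p ≈P [] → p *P q ≈P []
*P-zeroˡ []      q p≈0 n       = refl
*P-zeroˡ (a ∷ p) q p≈0 zero    = trans (coeff-*P-zero (a ∷ p) q) (cong (ℤ._* coeff q 0) (p≈0 0))
*P-zeroˡ (a ∷ p) q p≈0 (suc n) =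
  trans (coeff-∷*P-suc a p q n) (cong₂ (λ u v → u ℤ.* coeff q (suc n) ℤ.+ v) (p≈0 0) (*P-zeroˡ p q (p≈0 ∘ suc) n))

*P-zeroʳ : ∀ p q → q ≈P [] → p *P q ≈P []
*P-zeroʳ []      q q≈0 n       = refl
*P-zeroʳ (a ∷ p) q q≈0 zero    =
  trans (coeff-*P-zero (a ∷ p) q) (trans (cong (a ℤ.*_) (q≈0 0)) (ℤₚ.*-zeroʳ a))
*P-zeroʳ (a ∷ p) q q≈0 (suc n) =
  trans (coeff-∷*P-suc a p q n)
        (cong₂ ℤ._+_ (trans (cong (a ℤ.*_) (q≈0 (suc n))) (ℤₚ.*-zeroʳ a)) (*P-zeroʳ p q q≈0 n))

Degree≤ : Poly → ℕ → Set
Degree≤ p k = ∀ i → k < i → coeff p i ≡ 0ℤ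

HasDegree : Poly → ℕ → Set
HasDegree p k = Degree≤ p k × coeff p k ≢ 0ℤ

Degree≤0⇒tail≈0 : ∀ {a p} → Degree≤ (a ∷ p) 0 → p ≈P []
Degree≤0⇒tail≈0 d n = d (suc n) (s≤s z≤n)

coeff-*P-constˡ : ∀ p q → Degree≤ p 0 → ∀ n → coeff (p *P q) n ≡ coeff p 0 ℤ.* coeff q n
coeff-*P-constˡ []      q d n       = refl
coeff-*P-constˡ (a ∷ p) q d zero    = coeff-*P-zero (a ∷ p) q
coeff-*P-constˡ (a ∷ p) q d (suc n)
  rewrite coeff-∷*P-suc a p q n | *P-zeroˡ p q (Degree≤0⇒tail≈0 d) n = ℤₚ.+-identityʳ _

coeff-*P-constʳ : ∀ p q → Degree≤ q 0 → ∀ n → coeff (p *P q) n ≡ coeff p n ℤ.* coeff q 0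
coeff-*P-constʳ []      q d n       = refl
coeff-*P-constʳ (a ∷ p) q d zero    = coeff-*P-zero (a ∷ p) q
coeff-*P-constʳ (a ∷ p) q d (suc n)
  rewrite coeff-∷*P-suc a p q n | d (suc n) (s≤s z≤n) | coeff-*P-constʳ p q d n | ℤₚ.*-zeroʳ a = ℤₚ.+-identityˡ _

*P-Degree≤-lead : ∀ {p q} k l → Degree≤ p k → Degree≤ q l →
                  Degree≤ (p *P q) (k + l) × coeff (p *P q) (k + l) ≡ coeff p k ℤ.* coeff q l
*P-Degree≤-lead {[]}    k l dp dq = (λ i _ → refl) , refl
*P-Degree≤-lead {a ∷ p} {q} zero l dp dq =
  bound , coeff-*P-constˡ (a ∷ p) q dp l
  where
  bound : Degree≤ ((a ∷ p) *P q) l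
  bound i l<i = trans (coeff-*P-constˡ (a ∷ p) q dp i) (trans (cong (a ℤ.*_) (dq i l<i)) (ℤₚ.*-zeroʳ a))
*P-Degree≤-lead {a ∷ p} {q} (suc k) l dp dq = bound , lead
  where
  IH = *P-Degree≤-lead {p} {q} k l (λ i k<i → dp (suc i) (s≤s k<i)) dq
  bound : Degree≤ ((a ∷ p) *P q) (suc k + l)
  bound (suc n) (s≤s k+l<n)
    rewrite coeff-∷*P-suc a p q n | dq (suc n) (s≤s (ℕₚ.≤-trans (ℕₚ.m≤n+m l k) (ℕₚ.<⇒≤ k+l<n)))
          | proj₁ IH n k+l<n | ℤₚ.*-zeroʳ a = refl
  lead : coeff ((a ∷ p) *P q) (suc (k + l)) ≡ coeff p k ℤ.* coeff q l
  lead rewrite coeff-∷*P-suc a p q (k + l) | dq (suc (k + l)) (s≤s (ℕₚ.m≤n+m l k)) | proj₂ IH | ℤₚ.*-zeroʳ a =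
    ℤₚ.+-identityˡ _

≈[]⊎HasDegree : ∀ p → p ≈P [] ⊎ ∃[ k ] HasDegree p k
≈[]⊎HasDegree [] = inj₁ (λ n → refl)
≈[]⊎HasDegree (a ∷ p) with ≈[]⊎HasDegree p
... | inj₂ (k , dp , lead≢0) = inj₂ (suc k , (λ { (suc i) (s≤s k<i) → dp i k<i }) , lead≢0)
... | inj₁ p≈0 with a ℤₚ.≟ 0ℤ
...   | yes refl = inj₁ (λ { zero → refl ; (suc i) → p≈0 i })
...   | no a≢0   = inj₂ (0 , (λ { (suc i) _ → p≈0 i }) , a≢0)

coeff-applyUpTo-< : ∀ (u : ℕ → ℤ) n i → i < n → coeff (applyUpTo u n) i ≡ u i
coeff-applyUpTo-< u (suc n) zero    _         = refl
coeff-applyUpTo-< u (suc n) (suc i) (s≤s i<n) = coeff-applyUpTo-< (u ∘ suc) n i i<n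

coeff-applyUpTo-≥ : ∀ (u : ℕ → ℤ) n i → n ≤ i → coeff (applyUpTo u n) i ≡ 0ℤ
coeff-applyUpTo-≥ u zero    i       _         = refl
coeff-applyUpTo-≥ u (suc n) (suc i) (s≤s n≤i) = coeff-applyUpTo-≥ (u ∘ suc) n i n≤i

polyOf≡applyUpTo : ∀ m a → polyOf m a ≡ applyUpTo a (suc m)
polyOf≡applyUpTo m a = Listₚ.map-upTo a (suc m)

coeff-polyOf-≤ : ∀ m a i → i ≤ m → coeff (polyOf m a) i ≡ a i
coeff-polyOf-≤ m a i i≤m rewrite polyOf≡applyUpTo m a = coeff-applyUpTo-< a (suc m) i (s≤s i≤m)

coeff-polyOf-> : ∀ m a i → m < i → coeff (polyOf m a) i ≡ 0ℤ
coeff-polyOf-> m a i m<i rewrite polyOf≡applyUpTo m a = coeff-applyUpTo-≥ a (suc m) i m<i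

constant-unit : ∀ g → Degree≤ g 0 → ∣ coeff g 0 ∣ ≡ 1 → IsUnit g
constant-unit g deg ∣g₀∣≡1 with ∣i∣≡1⇒i≡±1 (coeff g 0) ∣g₀∣≡1
... | inj₁ g₀≡1  = inj₁ λ { zero → g₀≡1  ; (suc n) → deg (suc n) (s≤s z≤n) }
... | inj₂ g₀≡-1 = inj₂ λ { zero → g₀≡-1 ; (suc n) → deg (suc n) (s≤s z≤n) }

-- Polynomials in the shift operator

-- act p x t = ∑ⱼ pⱼ x (t + j), i.e. act p x = p(E) x for the shift E x = x ∘ suc.
act : Poly → (ℕ → ℤ) → ℕ → ℤ
act []      x t = 0ℤ
act (a ∷ p) x t = a ℤ.* x t ℤ.+ act p x (suc t)

act-cong : ∀ p x y t s → (∀ i → x (t + i) ≡ y (s + i)) → act p x t ≡ act p y s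
act-cong []      x y t s eq = refl
act-cong (a ∷ p) x y t s eq = cong₂ (λ u v → a ℤ.* u ℤ.+ v)
  (trans (cong x (sym (ℕₚ.+-identityʳ t))) (trans (eq 0) (cong y (ℕₚ.+-identityʳ s))))
  (act-cong p x y (suc t) (suc s) (λ i → trans (cong x (sym (ℕₚ.+-suc t i))) (trans (eq (suc i)) (cong y (ℕₚ.+-suc s i)))))

act-zero : ∀ p x t → (∀ i → x (t + i) ≡ 0ℤ) → act p x t ≡ 0ℤ
act-zero p x t x≡0 = trans (act-cong p x (λ _ → 0ℤ) t t x≡0) (act-0 p t)
  where
  act-0 : ∀ p t → act p (λ _ → 0ℤ) t ≡ 0ℤ
  act-0 []      t = refl
  act-0 (a ∷ p) t rewrite act-0 p (suc t) | ℤₚ.*-zeroʳ a = refl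

act-≈P : ∀ p q x t → p ≈P q → act p x t ≡ act q x t
act-≈P []      []      x t eq = refl
act-≈P []      (b ∷ q) x t eq rewrite sym (eq 0) =
  trans (act-≈P [] q x (suc t) (eq ∘ suc)) (sym (ℤₚ.+-identityˡ _))
act-≈P (a ∷ p) []      x t eq rewrite eq 0 =
  trans (ℤₚ.+-identityˡ _) (act-≈P p [] x (suc t) (eq ∘ suc))
act-≈P (a ∷ p) (b ∷ q) x t eq rewrite eq 0 = cong (λ v → b ℤ.* x t ℤ.+ v) (act-≈P p q x (suc t) (eq ∘ suc))

act-+P : ∀ p q x t → act (p +P q) x t ≡ act p x t ℤ.+ act q x t
act-+P []      q       x t = sym (ℤₚ.+-identityˡ _)
act-+P (a ∷ p) []      x t = sym (ℤₚ.+-identityʳ _)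
act-+P (a ∷ p) (b ∷ q) x t rewrite act-+P p q x (suc t) = regroup a b (x t) (act p x (suc t)) (act q x (suc t))
  where
  regroup : ∀ a b c u v → (a ℤ.+ b) ℤ.* c ℤ.+ (u ℤ.+ v) ≡ a ℤ.* c ℤ.+ u ℤ.+ (b ℤ.* c ℤ.+ v)
  regroup a b c u v = solve (a ∷ b ∷ c ∷ u ∷ v ∷ [])

act-map-* : ∀ c q x t → act (map (c ℤ.*_) q) x t ≡ c ℤ.* act q x t
act-map-* c []      x t = sym (ℤₚ.*-zeroʳ c)
act-map-* c (b ∷ q) x t rewrite act-map-* c q x (suc t) = regroup c b (x t) (act q x (suc t))
  where
  regroup : ∀ c b u v → c ℤ.* b ℤ.* u ℤ.+ c ℤ.* v ≡ c ℤ.* (b ℤ.* u ℤ.+ v)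
  regroup c b u v = solve (c ∷ b ∷ u ∷ v ∷ [])

act-*P : ∀ p q x t → act (p *P q) x t ≡ act p (act q x) t
act-*P []      q x t = refl
act-*P (a ∷ p) q x t
  rewrite act-+P (map (a ℤ.*_) q) (0ℤ ∷ (p *P q)) x t | act-map-* a q x t | act-*P p q x (suc t) =
  cong (λ v → a ℤ.* act q x t ℤ.+ v) (ℤₚ.+-identityˡ _)

act-*+ : ∀ p u x y t → act p (λ s → u ℤ.* x s ℤ.+ y s) t ≡ u ℤ.* act p x t ℤ.+ act p y t
act-*+ []      u x y t = solve (u ∷ [])
act-*+ (a ∷ p) u x y t rewrite act-*+ p u x y (suc t) =
  regroup a u (x t) (y t) (act p x (suc t)) (act p y (suc t))
  where
  regroup : ∀ a u xt yt px py → a ℤ.* (u ℤ.* xt ℤ.+ yt) ℤ.+ (u ℤ.* px ℤ.+ py) ≡ u ℤ.* (a ℤ.* xt ℤ.+ px) ℤ.+ (a ℤ.* yt ℤ.+ py)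
  regroup a u xt yt px py = solve (a ∷ u ∷ xt ∷ yt ∷ px ∷ py ∷ [])

act-*-* : ∀ p u v x y t → u ℤ.* act p x t ℤ.- v ℤ.* act p y t ≡ act p (λ s → u ℤ.* x s ℤ.- v ℤ.* y s) t
act-*-* []      u v x y t = solve (u ∷ v ∷ [])
act-*-* (a ∷ p) u v x y t rewrite sym (act-*-* p u v x y (suc t)) =
  regroup a u v (x t) (y t) (act p x (suc t)) (act p y (suc t))
  where
  regroup : ∀ a u v xt yt px py → u ℤ.* (a ℤ.* xt ℤ.+ px) ℤ.- v ℤ.* (a ℤ.* yt ℤ.+ py)
                                  ≡ a ℤ.* (u ℤ.* xt ℤ.- v ℤ.* yt) ℤ.+ (u ℤ.* px ℤ.- v ℤ.* py)
  regroup a u v xt yt px py = solve (a ∷ u ∷ v ∷ xt ∷ yt ∷ px ∷ py ∷ [])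

act-comm : ∀ p q x t → act p (act q x) t ≡ act q (act p x) t
act-comm []      q x t = sym (act-zero q (λ _ → 0ℤ) t (λ i → refl))
act-comm (a ∷ p) q x t = begin
  a ℤ.* act q x t ℤ.+ act p (act q x) (suc t)     ≡⟨ cong (λ v → a ℤ.* act q x t ℤ.+ v) (act-comm p q x (suc t)) ⟩
  a ℤ.* act q x t ℤ.+ act q (act p x) (suc t)     ≡⟨ cong (λ v → a ℤ.* act q x t ℤ.+ v) (act-cong q (act p x) (act p x ∘ suc) (suc t) t (λ i → refl)) ⟩
  a ℤ.* act q x t ℤ.+ act q (act p x ∘ suc) t     ≡⟨ sym (act-*+ q a x (act p x ∘ suc) t) ⟩
  act q (act (a ∷ p) x) t                          ∎
  where open ≡-Reasoning

act-lead : ∀ q l x t → Degree≤ q l → (∀ i → i < l → x (t + i) ≡ 0ℤ) → act q x t ≡ coeff q l ℤ.* x (t + l)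
act-lead []      l       x t d x≡0 = refl
act-lead (c ∷ q) zero    x t d x≡0 rewrite ℕₚ.+-identityʳ t =
  trans (cong (λ v → c ℤ.* x t ℤ.+ v) (act-≈P q [] x (suc t) (Degree≤0⇒tail≈0 d))) (ℤₚ.+-identityʳ _)
act-lead (c ∷ q) (suc l) x t d x≡0 = begin
  c ℤ.* x t ℤ.+ act q x (suc t)   ≡⟨ cong (λ u → c ℤ.* u ℤ.+ act q x (suc t)) (trans (cong x (sym (ℕₚ.+-identityʳ t))) (x≡0 0 (s≤s z≤n))) ⟩
  c ℤ.* 0ℤ ℤ.+ act q x (suc t)   ≡⟨ cong (ℤ._+ act q x (suc t)) (ℤₚ.*-zeroʳ c) ⟩
  0ℤ ℤ.+ act q x (suc t)         ≡⟨ ℤₚ.+-identityˡ _ ⟩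
  act q x (suc t)                 ≡⟨ act-lead q l x (suc t) (λ i l<i → d (suc i) (s≤s l<i))
                                        (λ i i<l → trans (cong x (sym (ℕₚ.+-suc t i))) (x≡0 (suc i) (s≤s i<l))) ⟩
  coeff q l ℤ.* x (suc t + l)     ≡⟨ cong (λ s → coeff q l ℤ.* x s) (sym (ℕₚ.+-suc t l)) ⟩
  coeff q l ℤ.* x (t + suc l)     ∎
  where open ≡-Reasoning

absSum : Poly → (ℕ → ℕ) → ℕ
absSum []      w = 0
absSum (a ∷ p) w = ∣ a ∣ * w 0 + absSum p (w ∘ suc)

absSum-*ʳ : ∀ p w c → absSum p (λ i → w i * c) ≡ absSum p w * c
absSum-*ʳ []      w c = refl
absSum-*ʳ (a ∷ p) w c rewrite absSum-*ʳ p (w ∘ suc) c = regroup ∣ a ∣ (w 0) c (absSum p (w ∘ suc))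
  where
  regroup : ∀ a w c s → a * (w * c) + s * c ≡ (a * w + s) * c
  regroup = solve-∀

act-bound : ∀ p x t K w → (∀ i → K * ∣ x (t + i) ∣ ≤ w i) → K * ∣ act p x t ∣ ≤ absSum p w
act-bound []      x t K w le = ℕₚ.≤-reflexive (ℕₚ.*-zeroʳ K)
act-bound (a ∷ p) x t K w le = begin
  K * ∣ a ℤ.* x t ℤ.+ act p x (suc t) ∣               ≤⟨ ℕₚ.*-monoʳ-≤ K (ℤₚ.∣i+j∣≤∣i∣+∣j∣ (a ℤ.* x t) _) ⟩
  K * (∣ a ℤ.* x t ∣ + ∣ act p x (suc t) ∣)           ≡⟨ cong (λ u → K * (u + ∣ act p x (suc t) ∣)) (ℤₚ.abs-* a (x t)) ⟩
  K * (∣ a ∣ * ∣ x t ∣ + ∣ act p x (suc t) ∣)         ≡⟨ regroup K ∣ a ∣ ∣ x t ∣ _ ⟩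
  ∣ a ∣ * (K * ∣ x t ∣) + K * ∣ act p x (suc t) ∣     ≤⟨ ℕₚ.+-mono-≤ (ℕₚ.*-monoʳ-≤ ∣ a ∣ head) (act-bound p x (suc t) K (w ∘ suc) tail) ⟩
  ∣ a ∣ * w 0 + absSum p (w ∘ suc)                     ∎
  where
  open ℕₚ.≤-Reasoning
  regroup : ∀ K a c s → K * (a * c + s) ≡ a * (K * c) + K * s
  regroup = solve-∀
  head : K * ∣ x t ∣ ≤ w 0
  head = subst (λ s → K * ∣ x s ∣ ≤ w 0) (ℕₚ.+-identityʳ t) (le 0)
  tail : ∀ i → K * ∣ x (suc t + i) ∣ ≤ w (suc i)
  tail i = subst (λ s → K * ∣ x s ∣ ≤ w (suc i)) (ℕₚ.+-suc t i) (le (suc i))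

annihilated∧eventually-zero⇒zero : ∀ p {x} → coeff p 0 ≢ 0ℤ → (∀ t → act p x t ≡ 0ℤ) →
                                   ∀ T → (∀ t → T ≤ t → x t ≡ 0ℤ) → ∀ t → x t ≡ 0ℤ
annihilated∧eventually-zero⇒zero []      p₀≢0 _    _ _      _ = ⊥-elim (p₀≢0 refl)
annihilated∧eventually-zero⇒zero (a ∷ p) {x} a≢0 px≡0 T late t = before T t (ℕₚ.m≤n+m T t)
  where
  before : ∀ j t → T ≤ t + j → x t ≡ 0ℤ
  before zero    t T≤t   = late t (subst (T ≤_) (ℕₚ.+-identityʳ t) T≤t)
  before (suc j) t T≤t+j = [ (λ a≡0 → ⊥-elim (a≢0 a≡0)) , (λ xt≡0 → xt≡0) ]′ (ℤₚ.i*j≡0⇒i≡0∨j≡0 a a*xₜ≡0)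
    where
    later : ∀ i → x (suc t + i) ≡ 0ℤ
    later i = before j (suc t + i)
      (ℕₚ.≤-trans T≤t+j (ℕₚ.≤-trans (ℕₚ.≤-reflexive (ℕₚ.+-suc t j)) (s≤s (ℕₚ.+-monoˡ-≤ j (ℕₚ.m≤m+n t i)))))
    a*xₜ≡0 : a ℤ.* x t ≡ 0ℤ
    a*xₜ≡0 = trans (sym (trans (cong (λ v → a ℤ.* x t ℤ.+ v) (act-zero p x (suc t) later)) (ℤₚ.+-identityʳ _))) (px≡0 t)

module _ (A : ℤ) where

  -- rescale e p = Aᵉ p (z / A) when deg p ≤ e.
  rescale : ℕ → Poly → Poly
  rescale e []      = []
  rescale e (c ∷ p) = c ℤ.* A ℤ.^ e ∷ rescale (e ∸ 1) p

  coeff-rescale : ∀ e p n → coeff (rescale e p) n ≡ coeff p n ℤ.* A ℤ.^ (e ∸ n)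
  coeff-rescale e []      n       = sym (ℤₚ.*-zeroˡ (A ℤ.^ (e ∸ n)))
  coeff-rescale e (c ∷ p) zero    = refl
  coeff-rescale e (c ∷ p) (suc n) =
    trans (coeff-rescale (e ∸ 1) p n) (cong (λ k → coeff p n ℤ.* A ℤ.^ k) (ℕₚ.∸-+-assoc e 1 n))

  rescale-≈P : ∀ e p q → p ≈P q → rescale e p ≈P rescale e q
  rescale-≈P e p q eq n =
    trans (coeff-rescale e p n) (trans (cong (ℤ._* A ℤ.^ (e ∸ n)) (eq n)) (sym (coeff-rescale e q n)))

  rescale-Degree≤ : ∀ k p → Degree≤ p k → Degree≤ (rescale k p) k
  rescale-Degree≤ k p d i k<i =
    trans (coeff-rescale k p i) (trans (cong (ℤ._* A ℤ.^ (k ∸ i)) (d i k<i)) (ℤₚ.*-zeroˡ (A ℤ.^ (k ∸ i))))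

  ^*coeff-rescale : ∀ k l q → Degree≤ q l → ∀ j → A ℤ.^ k ℤ.* coeff (rescale l q) j ≡ coeff q j ℤ.* A ℤ.^ (k + l ∸ j)
  ^*coeff-rescale k l q d j with j ℕ.≤? l
  ... | yes j≤l = begin
    A ℤ.^ k ℤ.* coeff (rescale l q) j              ≡⟨ cong (A ℤ.^ k ℤ.*_) (coeff-rescale l q j) ⟩
    A ℤ.^ k ℤ.* (coeff q j ℤ.* A ℤ.^ (l ∸ j))      ≡⟨ swap (A ℤ.^ k) (coeff q j) (A ℤ.^ (l ∸ j)) ⟩
    coeff q j ℤ.* (A ℤ.^ k ℤ.* A ℤ.^ (l ∸ j))      ≡⟨ cong (coeff q j ℤ.*_) (sym (ℤₚ.^-distribˡ-+-* A k (l ∸ j))) ⟩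
    coeff q j ℤ.* A ℤ.^ (k + (l ∸ j))              ≡⟨ cong (λ e → coeff q j ℤ.* A ℤ.^ e) (sym (ℕₚ.+-∸-assoc k j≤l)) ⟩
    coeff q j ℤ.* A ℤ.^ (k + l ∸ j)                ∎
    where
    open ≡-Reasoning
    swap : ∀ a b c → a ℤ.* (b ℤ.* c) ≡ b ℤ.* (a ℤ.* c)
    swap a b c = solve (a ∷ b ∷ c ∷ [])
  ... | no j≰l rewrite coeff-rescale l q j | d j (ℕₚ.≰⇒> j≰l) = ℤₚ.*-zeroʳ (A ℤ.^ k)

  rescale-*P : ∀ p q k l → Degree≤ p k → Degree≤ q l → rescale k p *P rescale l q ≈P rescale (k + l) (p *P q)
  rescale-*P []      q k l dp dq n = refl
  rescale-*P (a ∷ p) q k l dp dq zero = begin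
    coeff ((a ℤ.* A ℤ.^ k ∷ rescale (k ∸ 1) p) *P rescale l q) 0 ≡⟨ coeff-*P-zero (a ℤ.* A ℤ.^ k ∷ rescale (k ∸ 1) p) (rescale l q) ⟩
    a ℤ.* A ℤ.^ k ℤ.* coeff (rescale l q) 0                    ≡⟨ ℤₚ.*-assoc a (A ℤ.^ k) _ ⟩
    a ℤ.* (A ℤ.^ k ℤ.* coeff (rescale l q) 0)                  ≡⟨ cong (a ℤ.*_) (^*coeff-rescale k l q dq 0) ⟩
    a ℤ.* (coeff q 0 ℤ.* A ℤ.^ (k + l))                        ≡⟨ sym (ℤₚ.*-assoc a (coeff q 0) _) ⟩
    a ℤ.* coeff q 0 ℤ.* A ℤ.^ (k + l)                          ≡⟨ cong (ℤ._* A ℤ.^ (k + l)) (sym (coeff-*P-zero (a ∷ p) q)) ⟩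
    coeff ((a ∷ p) *P q) 0 ℤ.* A ℤ.^ (k + l)                   ≡⟨ sym (coeff-rescale (k + l) ((a ∷ p) *P q) 0) ⟩
    coeff (rescale (k + l) ((a ∷ p) *P q)) 0                   ∎
    where open ≡-Reasoning
  rescale-*P (a ∷ p) q k l dp dq (suc n) = begin
    coeff ((a ℤ.* A ℤ.^ k ∷ rescale (k ∸ 1) p) *P rescale l q) (suc n)
      ≡⟨ coeff-∷*P-suc (a ℤ.* A ℤ.^ k) (rescale (k ∸ 1) p) (rescale l q) n ⟩
    a ℤ.* A ℤ.^ k ℤ.* coeff (rescale l q) (suc n) ℤ.+ coeff (rescale (k ∸ 1) p *P rescale l q) n
      ≡⟨ cong₂ ℤ._+_ head (tail k dp) ⟩
    a ℤ.* coeff q (suc n) ℤ.* A ℤ.^ e ℤ.+ coeff (p *P q) n ℤ.* A ℤ.^ e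
      ≡⟨ sym (ℤₚ.*-distribʳ-+ (A ℤ.^ e) (a ℤ.* coeff q (suc n)) _) ⟩
    (a ℤ.* coeff q (suc n) ℤ.+ coeff (p *P q) n) ℤ.* A ℤ.^ e
      ≡⟨ cong (ℤ._* A ℤ.^ e) (sym (coeff-∷*P-suc a p q n)) ⟩
    coeff ((a ∷ p) *P q) (suc n) ℤ.* A ℤ.^ e
      ≡⟨ sym (coeff-rescale (k + l) ((a ∷ p) *P q) (suc n)) ⟩
    coeff (rescale (k + l) ((a ∷ p) *P q)) (suc n) ∎
    where
    open ≡-Reasoning
    e = k + l ∸ suc n
    head : a ℤ.* A ℤ.^ k ℤ.* coeff (rescale l q) (suc n) ≡ a ℤ.* coeff q (suc n) ℤ.* A ℤ.^ e
    head = trans (ℤₚ.*-assoc a (A ℤ.^ k) _)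
                 (trans (cong (a ℤ.*_) (^*coeff-rescale k l q dq (suc n))) (sym (ℤₚ.*-assoc a _ _)))
    tail : ∀ k → Degree≤ (a ∷ p) k → coeff (rescale (k ∸ 1) p *P rescale l q) n ≡ coeff (p *P q) n ℤ.* A ℤ.^ (k + l ∸ suc n)
    tail zero    dp = trans (*P-zeroˡ (rescale 0 p) (rescale l q) p'≈0 n)
                            (sym (trans (cong (ℤ._* A ℤ.^ (l ∸ suc n)) (*P-zeroˡ p q p≈0 n)) (ℤₚ.*-zeroˡ (A ℤ.^ (l ∸ suc n)))))
      where
      p≈0 : p ≈P []
      p≈0 = Degree≤0⇒tail≈0 dp
      p'≈0 : rescale 0 p ≈P []
      p'≈0 i = trans (coeff-rescale 0 p i) (trans (cong (ℤ._* A ℤ.^ (0 ∸ i)) (p≈0 i)) (ℤₚ.*-zeroˡ (A ℤ.^ (0 ∸ i))))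
    tail (suc k) dp =
      trans (rescale-*P p q k l (λ i k<i → dp (suc i) (s≤s k<i)) dq n) (coeff-rescale (k + l) (p *P q) n)

act-rescale-applyUpTo : ∀ A e u n x s →
                        act (rescale A e (applyUpTo u n)) x s ≡ sumℤ n (λ i → u i ℤ.* A ℤ.^ (e ∸ i) ℤ.* x (s + i))
act-rescale-applyUpTo A e u zero    x s = refl
act-rescale-applyUpTo A e u (suc n) x s =
  cong₂ ℤ._+_ (cong (λ t → u 0 ℤ.* A ℤ.^ e ℤ.* x t) (sym (ℕₚ.+-identityʳ s)))
    (trans (act-rescale-applyUpTo A (e ∸ 1) (u ∘ suc) n x (suc s))
      (sumℤ-cong n (λ i _ → cong₂ (λ k t → u (suc i) ℤ.* A ℤ.^ k ℤ.* x t) (ℕₚ.∸-+-assoc e 1 i) (sym (ℕₚ.+-suc s i)))))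

-- wedge x y p q = x_p x_q (y_p / x_p - y_q / x_q) measures how much the ratio y / x moves between p and q.
wedge : (ℕ → ℤ) → (ℕ → ℤ) → ℕ → ℕ → ℤ
wedge x y p q = x q ℤ.* y p ℤ.- y q ℤ.* x p

wedge-self : ∀ x y u → wedge x y u u ≡ 0ℤ
wedge-self x y u = cancel (x u) (y u)
  where
  cancel : ∀ a c → a ℤ.* c ℤ.- c ℤ.* a ≡ 0ℤ
  cancel a c = solve (a ∷ c ∷ [])

wedge-plücker : ∀ x y p q r → x q ℤ.* wedge x y p r ≡ x r ℤ.* wedge x y p q ℤ.+ x p ℤ.* wedge x y q r
wedge-plücker x y p q r = identity (x p) (x q) (x r) (y p) (y q) (y r)
  where
  identity : ∀ xp xq xr yp yq yr →
             xq ℤ.* (xr ℤ.* yp ℤ.- yr ℤ.* xp) ≡ xr ℤ.* (xq ℤ.* yp ℤ.- yq ℤ.* xp) ℤ.+ xp ℤ.* (xr ℤ.* yq ℤ.- yr ℤ.* xq)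
  identity xp xq xr yp yq yr = solve (xp ∷ xq ∷ xr ∷ yp ∷ yq ∷ yr ∷ [])

∣wedge∣-plücker : ∀ x y p q r →
                  ∣ x q ∣ * ∣ wedge x y p r ∣ ≤ ∣ x r ∣ * ∣ wedge x y p q ∣ + ∣ x p ∣ * ∣ wedge x y q r ∣
∣wedge∣-plücker x y p q r = begin
  ∣ x q ∣ * ∣ wedge x y p r ∣                                ≡⟨ sym (ℤₚ.abs-* (x q) (wedge x y p r)) ⟩
  ∣ x q ℤ.* wedge x y p r ∣                                  ≡⟨ cong ∣_∣ (wedge-plücker x y p q r) ⟩
  ∣ x r ℤ.* wedge x y p q ℤ.+ x p ℤ.* wedge x y q r ∣        ≤⟨ ℤₚ.∣i+j∣≤∣i∣+∣j∣ (x r ℤ.* wedge x y p q) _ ⟩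
  ∣ x r ℤ.* wedge x y p q ∣ + ∣ x p ℤ.* wedge x y q r ∣      ≡⟨ cong₂ _+_ (ℤₚ.abs-* (x r) _) (ℤₚ.abs-* (x p) _) ⟩
  ∣ x r ∣ * ∣ wedge x y p q ∣ + ∣ x p ∣ * ∣ wedge x y q r ∣  ∎
  where open ℕₚ.≤-Reasoning

WedgeBound : (x y : ℕ → ℤ) → ℕ → ℕ → ℕ → Set
WedgeBound x y D k s = 2 ^ k * ∣ wedge x y s (suc s) ∣ ≤ D * (∣ x s ∣ * ∣ x (suc s) ∣)

WedgeBound-weaken : ∀ {x y D k s} → WedgeBound x y D (suc k) s → WedgeBound x y D k s
WedgeBound-weaken {k = k} bound = ℕₚ.≤-trans (ℕₚ.*-monoˡ-≤ _ (ℕₚ.^-monoʳ-≤ 2 (ℕₚ.n≤1+n k))) bound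

-- Consecutive bounds add up along a stretch where x has no zero, via the Plücker relation.
wedge-telescope : ∀ x y D k T → (∀ t → T ≤ t → x t ≢ 0ℤ) → ∀ j u → T ≤ u →
                  (∀ r → r < j → WedgeBound x y D k (u + r)) →
                  2 ^ k * ∣ wedge x y u (u + j) ∣ ≤ j * D * (∣ x u ∣ * ∣ x (u + j) ∣)
wedge-telescope x y D k T x≢0 zero u T≤u bounds
  rewrite ℕₚ.+-identityʳ u | wedge-self x y u | ℕₚ.*-zeroʳ (2 ^ k) = z≤n
wedge-telescope x y D k T x≢0 (suc j) u T≤u bounds rewrite ℕₚ.+-suc u j =
  ℕₚ.*-cancelˡ-≤ Xs {{ℕ.>-nonZero (i≢0⇒∣i∣≥1 (x≢0 (suc u) (ℕₚ.≤-trans T≤u (ℕₚ.n≤1+n u))))}} (begin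
    Xs * (K * ∣ wedge x y u (suc u + j) ∣)                                      ≡⟨ x∙yz≈y∙xz Xs K _ ⟩
    K * (Xs * ∣ wedge x y u (suc u + j) ∣)                                      ≤⟨ ℕₚ.*-monoʳ-≤ K (∣wedge∣-plücker x y u (suc u) (suc u + j)) ⟩
    K * (XR * ∣ wedge x y u (suc u) ∣ + Xu * ∣ wedge x y (suc u) (suc u + j) ∣) ≡⟨ distribute K XR _ Xu _ ⟩
    XR * (K * ∣ wedge x y u (suc u) ∣) + Xu * (K * ∣ wedge x y (suc u) (suc u + j) ∣)
      ≤⟨ ℕₚ.+-mono-≤ (ℕₚ.*-monoʳ-≤ XR first) (ℕₚ.*-monoʳ-≤ Xu rest) ⟩
    XR * (D * (Xu * Xs)) + Xu * (j * D * (Xs * XR))                           ≡⟨ collect XR D Xu Xs j ⟩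
    Xs * (suc j * D * (Xu * XR))                                              ∎)
  where
  open ℕₚ.≤-Reasoning
  K = 2 ^ k
  Xu = ∣ x u ∣
  Xs = ∣ x (suc u) ∣
  XR = ∣ x (suc u + j) ∣
  first : K * ∣ wedge x y u (suc u) ∣ ≤ D * (Xu * Xs)
  first = subst (WedgeBound x y D k) (ℕₚ.+-identityʳ u) (bounds 0 (s≤s z≤n))
  rest : K * ∣ wedge x y (suc u) (suc u + j) ∣ ≤ j * D * (Xs * XR)
  rest = wedge-telescope x y D k T x≢0 j (suc u) (ℕₚ.≤-trans T≤u (ℕₚ.n≤1+n u))
           (λ r r<j → subst (WedgeBound x y D k) (ℕₚ.+-suc u r) (bounds (suc r) (s≤s r<j)))
  distribute : ∀ K a c d e → K * (a * c + d * e) ≡ a * (K * c) + d * (K * e)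
  distribute = solve-∀
  collect : ∀ XR D Xu Xs j → XR * (D * (Xu * Xs)) + Xu * (j * D * (Xs * XR)) ≡ Xs * (suc j * D * (Xu * XR))
  collect = solve-∀

module Recurrence (N : ℕ) (a₁ : ℤ) (b : ℕ → ℤ) (gap : sumℕ N (∣_∣ ∘ b) + 2 ≤ ∣ a₁ ∣) where

  B : ℕ
  B = sumℕ N (∣_∣ ∘ b)

  α : ℕ
  α = ∣ a₁ ∣

  rest : (ℕ → ℤ) → ℕ → ℤ
  rest x s = sumℤ N (λ i → b i ℤ.* x (s + i))

  restAbs : (ℕ → ℤ) → ℕ → ℕ
  restAbs x s = sumℕ N (λ i → ∣ b i ∣ * ∣ x (s + i) ∣)

  record Solution (x : ℕ → ℤ) : Set where
    constructor solution
    field recurrence : ∀ s → x (suc (s + N)) ≡ ℤ.- (a₁ ℤ.* x (s + N) ℤ.+ rest x s)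
  open Solution public

  ∣rest∣≤restAbs : ∀ x s → ∣ rest x s ∣ ≤ restAbs x s
  ∣rest∣≤restAbs x s =
    ℕₚ.≤-trans (∣sumℤ∣≤sumℕ∣∣ N _) (ℕₚ.≤-reflexive (sumℕ-cong N (λ i _ → ℤₚ.abs-* (b i) (x (s + i)))))

  restAbs-bound : ∀ x s μ Z → (∀ i → i < N → μ * ∣ x (s + i) ∣ ≤ Z) → μ * restAbs x s ≤ B * Z
  restAbs-bound x s μ Z le = begin
    μ * restAbs x s                                    ≡⟨ sym (sumℕ-*ˡ N μ _) ⟩
    sumℕ N (λ i → μ * (∣ b i ∣ * ∣ x (s + i) ∣))       ≡⟨ sumℕ-cong N (λ i _ → x∙yz≈y∙xz μ ∣ b i ∣ ∣ x (s + i) ∣) ⟩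
    sumℕ N (λ i → ∣ b i ∣ * (μ * ∣ x (s + i) ∣))       ≤⟨ sumℕ-mono-≤ N (λ i i<N → ℕₚ.*-monoʳ-≤ ∣ b i ∣ (le i i<N)) ⟩
    sumℕ N (λ i → ∣ b i ∣ * Z)                         ≡⟨ sumℕ-*ʳ N (∣_∣ ∘ b) Z ⟩
    B * Z                                              ∎
    where
    open ℕₚ.≤-Reasoning

  α*∣x∣≤∣next∣+restAbs : ∀ {x} → Solution x → ∀ s → α * ∣ x (s + N) ∣ ≤ ∣ x (suc (s + N)) ∣ + restAbs x s
  α*∣x∣≤∣next∣+restAbs {x} sol s = begin
    α * ∣ x (s + N) ∣                  ≡⟨ sym (ℤₚ.abs-* a₁ (x (s + N))) ⟩
    ∣ a₁ ℤ.* x (s + N) ∣               ≡⟨ cong ∣_∣ (isolate (x (suc (s + N))) (a₁ ℤ.* x (s + N)) (rest x s) (recurrence sol s)) ⟩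
    ∣ ℤ.- x (suc (s + N)) ℤ.- rest x s ∣ ≤⟨ ℤₚ.∣i-j∣≤∣i∣+∣j∣ (ℤ.- x (suc (s + N))) (rest x s) ⟩
    ∣ ℤ.- x (suc (s + N)) ∣ + ∣ rest x s ∣ ≤⟨ ℕₚ.+-mono-≤ (ℕₚ.≤-reflexive (ℤₚ.∣-i∣≡∣i∣ (x (suc (s + N))))) (∣rest∣≤restAbs x s) ⟩
    ∣ x (suc (s + N)) ∣ + restAbs x s  ∎
    where
    open ℕₚ.≤-Reasoning
    isolate : ∀ u p r → u ≡ ℤ.- (p ℤ.+ r) → p ≡ ℤ.- u ℤ.- r
    isolate u p r refl = solve (p ∷ r ∷ [])

  ∣next∣≤α*∣x∣+restAbs : ∀ {x} → Solution x → ∀ s → ∣ x (suc (s + N)) ∣ ≤ α * ∣ x (s + N) ∣ + restAbs x s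
  ∣next∣≤α*∣x∣+restAbs {x} sol s = begin
    ∣ x (suc (s + N)) ∣                        ≡⟨ cong ∣_∣ (recurrence sol s) ⟩
    ∣ ℤ.- (a₁ ℤ.* x (s + N) ℤ.+ rest x s) ∣    ≡⟨ ℤₚ.∣-i∣≡∣i∣ (a₁ ℤ.* x (s + N) ℤ.+ rest x s) ⟩
    ∣ a₁ ℤ.* x (s + N) ℤ.+ rest x s ∣          ≤⟨ ℤₚ.∣i+j∣≤∣i∣+∣j∣ (a₁ ℤ.* x (s + N)) (rest x s) ⟩
    ∣ a₁ ℤ.* x (s + N) ∣ + ∣ rest x s ∣        ≤⟨ ℕₚ.+-mono-≤ (ℕₚ.≤-reflexive (ℤₚ.abs-* a₁ (x (s + N)))) (∣rest∣≤restAbs x s) ⟩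
    α * ∣ x (s + N) ∣ + restAbs x s            ∎
    where open ℕₚ.≤-Reasoning

  -- Dominated windows and geometric growth

  -- ρ and Λ bound the ratio |xₜ₊₁ / xₜ| of a solution that is eventually dominated by its newest term;
  -- ρ = α - ⌈B/2⌉ is chosen so that ρ² + B ≤ ρ α and 2 B ≤ ρ².
  h : ℕ
  h = ⌈ B /2⌉

  ρ : ℕ
  ρ = α ∸ h

  Λ : ℕ
  Λ = α + B

  2*h+1≤α : suc (2 * h) ≤ α
  2*h+1≤α = ℕₚ.≤-trans (s≤s (2*⌈n/2⌉≤1+n B)) (ℕₚ.≤-trans (ℕₚ.≤-reflexive (ℕₚ.+-comm 2 B)) gap)

  ρ+h≡α : ρ + h ≡ α
  ρ+h≡α = ℕₚ.m∸n+n≡m (ℕₚ.≤-trans (ℕₚ.m≤m+n h (h + 0)) (ℕₚ.≤-trans (ℕₚ.n≤1+n _) 2*h+1≤α))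

  h<ρ : h < ρ
  h<ρ = ℕₚ.+-cancelʳ-≤ h (suc h) ρ
          (ℕₚ.≤-trans (ℕₚ.≤-reflexive (1+h+h≡1+2*h h)) (ℕₚ.≤-trans 2*h+1≤α (ℕₚ.≤-reflexive (sym ρ+h≡α))))
    where
    1+h+h≡1+2*h : ∀ h → suc h + h ≡ suc (2 * h)
    1+h+h≡1+2*h = solve-∀

  2≤ρ : 2 ≤ ρ
  2≤ρ = ℕₚ.+-cancelʳ-≤ h 2 ρ (ℕₚ.≤-trans h+2≤α (ℕₚ.≤-reflexive (sym ρ+h≡α)))
    where
    h+2≤α : 2 + h ≤ α
    h+2≤α = ℕₚ.≤-trans (ℕₚ.+-monoʳ-≤ 2 (ℕₚ.⌈n/2⌉≤n B)) (ℕₚ.≤-trans (ℕₚ.≤-reflexive (ℕₚ.+-comm 2 B)) gap)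

  1≤ρ : 1 ≤ ρ
  1≤ρ = ℕₚ.≤-trans (s≤s z≤n) 2≤ρ

  2*1+B≤1*α : 2 * 1 + B ≤ 1 * α
  2*1+B≤1*α = ℕₚ.≤-trans (ℕₚ.≤-reflexive (ℕₚ.+-comm 2 B)) (ℕₚ.≤-trans gap (ℕₚ.≤-reflexive (sym (ℕₚ.*-identityˡ α))))

  ρ*2+B≤2*α : ρ * 2 + B ≤ 2 * α
  ρ*2+B≤2*α = begin
    ρ * 2 + B      ≤⟨ ℕₚ.+-monoʳ-≤ (ρ * 2) (n≤2*⌈n/2⌉ B) ⟩
    ρ * 2 + 2 * h  ≡⟨ distrib ρ h ⟩
    2 * (ρ + h)    ≡⟨ cong (2 *_) ρ+h≡α ⟩
    2 * α          ∎
    where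
    open ℕₚ.≤-Reasoning
    distrib : ∀ r h → r * 2 + 2 * h ≡ 2 * (r + h)
    distrib = solve-∀

  ρ*ρ+B≤ρ*α : ρ * ρ + B ≤ ρ * α
  ρ*ρ+B≤ρ*α = begin
    ρ * ρ + B        ≤⟨ ℕₚ.+-monoʳ-≤ (ρ * ρ) (ℕₚ.≤-trans (n≤2*⌈n/2⌉ B) (ℕₚ.*-monoˡ-≤ h 2≤ρ)) ⟩
    ρ * ρ + ρ * h    ≡⟨ sym (ℕₚ.*-distribˡ-+ ρ ρ h) ⟩
    ρ * (ρ + h)      ≡⟨ cong (ρ *_) ρ+h≡α ⟩
    ρ * α            ∎
    where open ℕₚ.≤-Reasoning

  2*B≤ρ*ρ : 2 * B ≤ ρ * ρ
  2*B≤ρ*ρ = begin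
    2 * B              ≤⟨ ℕₚ.*-monoʳ-≤ 2 (n≤2*⌈n/2⌉ B) ⟩
    2 * (2 * h)        ≡⟨ sym (ℕₚ.*-assoc 2 2 h) ⟩
    4 * h              ≤⟨ 4*n≤[1+n]² h ⟩
    suc h * suc h      ≤⟨ ℕₚ.*-mono-≤ h<ρ h<ρ ⟩
    ρ * ρ              ∎
    where open ℕₚ.≤-Reasoning

  Leads : ℕ → (ℕ → ℤ) → ℕ → Set
  Leads μ x s = x (s + N) ≢ 0ℤ × (∀ i → i < N → μ * ∣ x (s + i) ∣ ≤ ∣ x (s + N) ∣)

  leads-next : ∀ {x} → Solution x → ∀ μ ν {s} → 1 ≤ μ → ν * μ + B ≤ μ * α →
               Leads μ x s → ν * ∣ x (s + N) ∣ ≤ ∣ x (suc (s + N)) ∣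
  leads-next {x} sol (suc μ') ν {s} _ cond (_ , older≤) = ℕₚ.*-cancelˡ-≤ μ (begin
    μ * (ν * X)                 ≡⟨ reorder μ ν X ⟩
    ν * μ * X                   ≤⟨ ℕₚ.+-cancelʳ-≤ (B * X) _ _ (begin
      ν * μ * X + B * X           ≡⟨ sym (ℕₚ.*-distribʳ-+ X (ν * μ) B) ⟩
      (ν * μ + B) * X             ≤⟨ ℕₚ.*-monoˡ-≤ X cond ⟩
      μ * α * X                   ≡⟨ ℕₚ.*-assoc μ α X ⟩
      μ * (α * X)                 ≤⟨ ℕₚ.*-monoʳ-≤ μ (α*∣x∣≤∣next∣+restAbs sol s) ⟩
      μ * (U + restAbs x s)       ≡⟨ ℕₚ.*-distribˡ-+ μ U (restAbs x s) ⟩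
      μ * U + μ * restAbs x s     ≤⟨ ℕₚ.+-monoʳ-≤ (μ * U) (restAbs-bound x s μ X older≤) ⟩
      μ * U + B * X               ∎) ⟩
    μ * U                       ∎)
    where
    open ℕₚ.≤-Reasoning
    μ = suc μ'
    X = ∣ x (s + N) ∣
    U = ∣ x (suc (s + N)) ∣
    reorder : ∀ μ ν X → μ * (ν * X) ≡ ν * μ * X
    reorder = solve-∀

  leads-step : ∀ {x} → Solution x → ∀ μ ν {s} → 1 ≤ μ → 1 ≤ ν → ν * μ + B ≤ μ * α →
               Leads μ x s → Leads ν x (suc s)
  leads-step {x} sol μ ν {s} 1≤μ 1≤ν cond lead@(x≢0 , older≤) = next≢0 , window
    where
    X = ∣ x (s + N) ∣
    U = ∣ x (suc (s + N)) ∣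
    νX≤U : ν * X ≤ U
    νX≤U = leads-next sol μ ν 1≤μ cond lead
    next≢0 : x (suc s + N) ≢ 0ℤ
    next≢0 = ∣i∣≥1⇒i≢0 (ℕₚ.≤-trans (ℕₚ.*-mono-≤ 1≤ν (i≢0⇒∣i∣≥1 x≢0)) νX≤U)
    window : ∀ i → i < N → ν * ∣ x (suc s + i) ∣ ≤ ∣ x (suc s + N) ∣
    window i i<N with suc i ℕ.<? N
    ... | yes 1+i<N = ℕₚ.≤-trans (ℕₚ.*-monoʳ-≤ ν older≤X) νX≤U
      where
      older≤X : ∣ x (suc s + i) ∣ ≤ X
      older≤X = ℕₚ.≤-trans (ℕₚ.m≤n*m _ μ {{ℕ.>-nonZero 1≤μ}})
                  (subst (λ t → μ * ∣ x t ∣ ≤ X) (ℕₚ.+-suc s i) (older≤ (suc i) 1+i<N))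
    ... | no 1+i≮N = subst (λ t → ν * ∣ x t ∣ ≤ U) (trans (cong (s +_) (sym 1+i≡N)) (ℕₚ.+-suc s i)) νX≤U
      where
      1+i≡N : suc i ≡ N
      1+i≡N = ℕₚ.≤-antisym i<N (ℕₚ.≮⇒≥ 1+i≮N)

  leads₁⇒leadsρ : ∀ {x} → Solution x → ∀ {s} → Leads 1 x s → ∀ j → Leads ρ x (j + suc (suc s))
  leads₁⇒leadsρ sol lead zero    =
    leads-step sol 2 ρ (s≤s z≤n) 1≤ρ ρ*2+B≤2*α (leads-step sol 1 2 (s≤s z≤n) (s≤s z≤n) 2*1+B≤1*α lead)
  leads₁⇒leadsρ sol lead (suc j) = leads-step sol ρ ρ 1≤ρ 1≤ρ ρ*ρ+B≤ρ*α (leads₁⇒leadsρ sol lead j)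

  Grows : (ℕ → ℤ) → ℕ → Set
  Grows x T = ∀ t → T ≤ t → x t ≢ 0ℤ × ρ * ∣ x t ∣ ≤ ∣ x (suc t) ∣ × ∣ x (suc t) ∣ ≤ Λ * ∣ x t ∣

  grows-mono : ∀ {x T T'} → T ≤ T' → Grows x T → Grows x T'
  grows-mono T≤T' grows t T'≤t = grows t (ℕₚ.≤-trans T≤T' T'≤t)

  leadsρ⇒grows : ∀ {x} → Solution x → ∀ s₁ → (∀ j → Leads ρ x (j + s₁)) → Grows x (s₁ + N)
  leadsρ⇒grows {x} sol s₁ lead = from-shifted N s₁ at
    where
    at : ∀ s → s₁ ≤ s → x (s + N) ≢ 0ℤ × ρ * ∣ x (s + N) ∣ ≤ ∣ x (suc (s + N)) ∣ × ∣ x (suc (s + N)) ∣ ≤ Λ * ∣ x (s + N) ∣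
    at s s₁≤s = proj₁ leadₛ , leads-next sol ρ ρ 1≤ρ ρ*ρ+B≤ρ*α leadₛ , upper
      where
      leadₛ : Leads ρ x s
      leadₛ = subst (Leads ρ x) (ℕₚ.m∸n+n≡m s₁≤s) (lead (s ∸ s₁))
      X = ∣ x (s + N) ∣
      upper : ∣ x (suc (s + N)) ∣ ≤ Λ * X
      upper = begin
        ∣ x (suc (s + N)) ∣       ≤⟨ ∣next∣≤α*∣x∣+restAbs sol s ⟩
        α * X + restAbs x s       ≡⟨ cong (λ r → α * X + r) (sym (ℕₚ.*-identityˡ (restAbs x s))) ⟩
        α * X + 1 * restAbs x s   ≤⟨ ℕₚ.+-monoʳ-≤ (α * X) (restAbs-bound x s 1 X older≤X) ⟩
        α * X + B * X             ≡⟨ sym (ℕₚ.*-distribʳ-+ X α B) ⟩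
        Λ * X                     ∎
        where
        open ℕₚ.≤-Reasoning
        older≤X : ∀ i → i < N → 1 * ∣ x (s + i) ∣ ≤ X
        older≤X i i<N = ℕₚ.≤-trans (ℕₚ.*-monoˡ-≤ ∣ x (s + i) ∣ 1≤ρ) (proj₂ leadₛ i i<N)

  leads⇒grows : ∀ {x} → Solution x → ∀ {s} → Leads 1 x s → Grows x (suc (suc s) + N)
  leads⇒grows sol {s} lead = leadsρ⇒grows sol (suc (suc s)) (leads₁⇒leadsρ sol lead)

  grows-lower : ∀ {x T} → Grows x T → ∀ u → T ≤ u → ∀ j → ρ ^ j * ∣ x u ∣ ≤ ∣ x (u + j) ∣
  grows-lower grows u T≤u zero    rewrite ℕₚ.+-identityʳ u = ℕₚ.≤-reflexive (ℕₚ.*-identityˡ _)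
  grows-lower grows u T≤u (suc j) rewrite ℕₚ.+-suc u j =
    ℕₚ.≤-trans (ℕₚ.≤-reflexive (ℕₚ.*-assoc ρ (ρ ^ j) _))
      (ℕₚ.≤-trans (ℕₚ.*-monoʳ-≤ ρ (grows-lower grows u T≤u j))
        (proj₁ (proj₂ (grows (u + j) (ℕₚ.≤-trans T≤u (ℕₚ.m≤m+n u j))))))

  grows-upper : ∀ {x T} → Grows x T → ∀ u → T ≤ u → ∀ j → ∣ x (u + j) ∣ ≤ Λ ^ j * ∣ x u ∣
  grows-upper grows u T≤u zero    rewrite ℕₚ.+-identityʳ u = ℕₚ.≤-reflexive (sym (ℕₚ.*-identityˡ _))
  grows-upper grows u T≤u (suc j) rewrite ℕₚ.+-suc u j =
    ℕₚ.≤-trans (proj₂ (proj₂ (grows (u + j) (ℕₚ.≤-trans T≤u (ℕₚ.m≤m+n u j)))))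
      (ℕₚ.≤-trans (ℕₚ.*-monoʳ-≤ Λ (grows-upper grows u T≤u j)) (ℕₚ.≤-reflexive (sym (ℕₚ.*-assoc Λ (Λ ^ j) _))))

  -- Undominated solutions vanish

  -- A window bounded by K + 1 cannot end in ±(K + 1): the recurrence would force α ≤ 1 + B.
  bounded⇒shrinks : ∀ {x} → Solution x → ∀ s₀ K → (∀ t → s₀ ≤ t → ∣ x t ∣ ≤ suc K) →
                    ∀ t → s₀ + N ≤ t → ∣ x t ∣ ≤ K
  bounded⇒shrinks {x} sol s₀ K bound = from-shifted N s₀ at
    where
    at : ∀ s → s₀ ≤ s → ∣ x (s + N) ∣ ≤ K
    at s s₀≤s with ∣ x (s + N) ∣ ℕ.≤? K
    ... | yes X≤K = X≤K
    ... | no  X≰K = ⊥-elim (ℕₚ.<-irrefl refl (ℕₚ.<-≤-trans (ℕₚ.m<m+n _ (s≤s z≤n)) (begin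
      (suc K + B * suc K) + suc K    ≡⟨ regroup K B ⟩
      (B + 2) * suc K                ≤⟨ ℕₚ.*-monoˡ-≤ (suc K) gap ⟩
      α * suc K                      ≡⟨ cong (α *_) (sym X≡1+K) ⟩
      α * ∣ x (s + N) ∣              ≤⟨ α*∣x∣≤∣next∣+restAbs sol s ⟩
      ∣ x (suc (s + N)) ∣ + restAbs x s ≤⟨ ℕₚ.+-mono-≤ (bound _ (ℕₚ.≤-trans s₀≤s (ℕₚ.≤-trans (ℕₚ.m≤m+n s N) (ℕₚ.n≤1+n _))))
                                                         (ℕₚ.≤-trans (ℕₚ.≤-reflexive (sym (ℕₚ.*-identityˡ _))) (restAbs-bound x s 1 (suc K) older≤)) ⟩
      suc K + B * suc K              ∎)))
      where
      open ℕₚ.≤-Reasoning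
      X≡1+K : ∣ x (s + N) ∣ ≡ suc K
      X≡1+K = ℕₚ.≤-antisym (bound (s + N) (ℕₚ.≤-trans s₀≤s (ℕₚ.m≤m+n s N))) (ℕₚ.≰⇒> X≰K)
      older≤ : ∀ i → i < N → 1 * ∣ x (s + i) ∣ ≤ suc K
      older≤ i _ = ℕₚ.≤-trans (ℕₚ.≤-reflexive (ℕₚ.*-identityˡ _)) (bound (s + i) (ℕₚ.≤-trans s₀≤s (ℕₚ.m≤m+n s i)))
      regroup : ∀ K B → suc K + B * suc K + suc K ≡ (B + 2) * suc K
      regroup = solve-∀

  bounded⇒eventually-zero : ∀ {x} → Solution x → ∀ K s₀ → (∀ t → s₀ ≤ t → ∣ x t ∣ ≤ K) →
                            ∀ t → s₀ + K * N ≤ t → x t ≡ 0ℤ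
  bounded⇒eventually-zero sol zero    s₀ bound t s₀+0≤t =
    ℤₚ.∣i∣≡0⇒i≡0 (ℕₚ.n≤0⇒n≡0 (bound t (ℕₚ.≤-trans (ℕₚ.m≤m+n s₀ 0) s₀+0≤t)))
  bounded⇒eventually-zero sol (suc K) s₀ bound t le =
    bounded⇒eventually-zero sol K (s₀ + N) (bounded⇒shrinks sol s₀ K bound) t
      (ℕₚ.≤-trans (ℕₚ.≤-reflexive (ℕₚ.+-assoc s₀ N (K * N))) le)

  -- Without leading windows no entry exceeds K = ∑_{i<N} |xᵢ|: the first to do so would lead its window.
  ¬leads⇒eventually-zero : ∀ {x} → Solution x → (∀ s → ¬ Leads 1 x s) → ∃[ T ] (∀ t → T ≤ t → x t ≡ 0ℤ)
  ¬leads⇒eventually-zero {x} sol ¬lead = K * N , bounded⇒eventually-zero sol K 0 (λ t _ → bounded t)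
    where
    K = sumℕ N (∣_∣ ∘ x)
    bounded : ∀ t → ∣ x t ∣ ≤ K
    bounded = <-rec (λ t → ∣ x t ∣ ≤ K) bound
      where
      bound : ∀ t → (∀ {t'} → t' < t → ∣ x t' ∣ ≤ K) → ∣ x t ∣ ≤ K
      bound t earlier with t ℕ.<? N
      ... | yes t<N = term≤sumℕ N (∣_∣ ∘ x) t<N
      ... | no  t≮N = subst (λ t → ∣ x t ∣ ≤ K) t-N+N≡t (newest (t ∸ N) (ℕₚ.≤-reflexive t-N+N≡t))
        where
        t-N+N≡t : t ∸ N + N ≡ t
        t-N+N≡t = ℕₚ.m∸n+n≡m (ℕₚ.≮⇒≥ t≮N)
        newest : ∀ s → s + N ≤ t → ∣ x (s + N) ∣ ≤ K
        newest s s+N≤t with ∣ x (s + N) ∣ ℕ.≤? K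
        ... | yes X≤K = X≤K
        ... | no  X≰K = ⊥-elim (¬lead s (∣i∣≥1⇒i≢0 (ℕₚ.≤-trans (s≤s z≤n) K<X) , older≤X))
          where
          K<X : K < ∣ x (s + N) ∣
          K<X = ℕₚ.≰⇒> X≰K
          older≤X : ∀ i → i < N → 1 * ∣ x (s + i) ∣ ≤ ∣ x (s + N) ∣
          older≤X i i<N = ℕₚ.≤-trans (ℕₚ.≤-reflexive (ℕₚ.*-identityˡ _))
            (ℕₚ.≤-trans (earlier (ℕₚ.<-≤-trans (ℕₚ.+-monoʳ-< s i<N) s+N≤t)) (ℕₚ.<⇒≤ K<X))

  -- Comparison of two solutions

  wedge-next : ∀ {x y} → Solution x → Solution y → ∀ s →
               wedge x y (s + N) (suc (s + N)) ≡ sumℤ N (λ i → b i ℤ.* wedge x y (s + i) (s + N))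
  wedge-next {x} {y} solx soly s = begin
    wedge x y (s + N) (suc (s + N))                                      ≡⟨ cong₂ (λ u v → u ℤ.* Y ℤ.- v ℤ.* X) (recurrence solx s) (recurrence soly s) ⟩
    ℤ.- (a₁ ℤ.* X ℤ.+ rest x s) ℤ.* Y ℤ.- ℤ.- (a₁ ℤ.* Y ℤ.+ rest y s) ℤ.* X ≡⟨ cancel a₁ X Y (rest x s) (rest y s) ⟩
    X ℤ.* rest y s ℤ.- Y ℤ.* rest x s                                    ≡⟨ cong₂ ℤ._-_ (sym (sumℤ-*ˡ N X _)) (sym (sumℤ-*ˡ N Y _)) ⟩
    sumℤ N (λ i → X ℤ.* (b i ℤ.* y (s + i))) ℤ.- sumℤ N (λ i → Y ℤ.* (b i ℤ.* x (s + i))) ≡⟨ sym (sumℤ-sub N _ _) ⟩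
    sumℤ N (λ i → X ℤ.* (b i ℤ.* y (s + i)) ℤ.- Y ℤ.* (b i ℤ.* x (s + i))) ≡⟨ sumℤ-cong N (λ i _ → factor X Y (b i) (x (s + i)) (y (s + i))) ⟩
    sumℤ N (λ i → b i ℤ.* wedge x y (s + i) (s + N))                     ∎
    where
    open ≡-Reasoning
    X = x (s + N)
    Y = y (s + N)
    cancel : ∀ a X Y Sx Sy → ℤ.- (a ℤ.* X ℤ.+ Sx) ℤ.* Y ℤ.- ℤ.- (a ℤ.* Y ℤ.+ Sy) ℤ.* X ≡ X ℤ.* Sy ℤ.- Y ℤ.* Sx
    cancel a X Y Sx Sy = solve (a ∷ X ∷ Y ∷ Sx ∷ Sy ∷ [])
    factor : ∀ X Y c u v → X ℤ.* (c ℤ.* v) ℤ.- Y ℤ.* (c ℤ.* u) ≡ c ℤ.* (X ℤ.* v ℤ.- Y ℤ.* u)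
    factor X Y c u v = solve (X ∷ Y ∷ c ∷ u ∷ v ∷ [])

  weightedRest : (ℕ → ℤ) → ℕ → ℕ
  weightedRest x s = sumℕ N (λ i → ∣ b i ∣ * ((N ∸ i) * ∣ x (s + i) ∣))

  2*weightedRest≤next : ∀ {x T} → Grows x T → ∀ s → T ≤ s → 2 * weightedRest x s ≤ ∣ x (suc (s + N)) ∣
  2*weightedRest≤next {x} {T} grows s T≤s = ℕₚ.*-cancelˡ-≤ (ρ * ρ) {{ρ²≢0}} (begin
    ρ * ρ * (2 * weightedRest x s)   ≡⟨ x∙yz≈y∙xz (ρ * ρ) 2 _ ⟩
    2 * (ρ * ρ * weightedRest x s)   ≤⟨ ℕₚ.*-monoʳ-≤ 2 ρ²*weighted≤B*U ⟩
    2 * (B * U)                      ≡⟨ sym (ℕₚ.*-assoc 2 B U) ⟩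
    2 * B * U                        ≤⟨ ℕₚ.*-monoˡ-≤ U 2*B≤ρ*ρ ⟩
    ρ * ρ * U                        ∎)
    where
    open ℕₚ.≤-Reasoning
    U = ∣ x (suc (s + N)) ∣
    ρ²≢0 : ℕ.NonZero (ρ * ρ)
    ρ²≢0 = ℕ.>-nonZero (ℕₚ.*-mono-≤ 1≤ρ 1≤ρ)
    term : ∀ i → i < N → ρ * ρ * ((N ∸ i) * ∣ x (s + i) ∣) ≤ U
    term i i<N = begin
      ρ * ρ * ((N ∸ i) * ∣ x (s + i) ∣)     ≡⟨ reassoc ρ (N ∸ i) ∣ x (s + i) ∣ ⟩
      ρ * (ρ * (N ∸ i) * ∣ x (s + i) ∣)     ≤⟨ ℕₚ.*-monoʳ-≤ ρ (ℕₚ.*-monoˡ-≤ ∣ x (s + i) ∣ (m*n≤m^n 2≤ρ (N ∸ i))) ⟩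
      ρ * (ρ ^ (N ∸ i) * ∣ x (s + i) ∣)     ≤⟨ ℕₚ.*-monoʳ-≤ ρ (ℕₚ.≤-trans (grows-lower grows (s + i) (ℕₚ.≤-trans T≤s (ℕₚ.m≤m+n s i)) (N ∸ i))
                                                                   (ℕₚ.≤-reflexive (cong (∣_∣ ∘ x) (m+n+[o∸n]≡m+o s (ℕₚ.<⇒≤ i<N))))) ⟩
      ρ * ∣ x (s + N) ∣                     ≤⟨ proj₁ (proj₂ (grows (s + N) (ℕₚ.≤-trans T≤s (ℕₚ.m≤m+n s N)))) ⟩
      U                                     ∎
      where
      reassoc : ∀ r j v → r * r * (j * v) ≡ r * (r * j * v)
      reassoc = solve-∀
    ρ²*weighted≤B*U : ρ * ρ * weightedRest x s ≤ B * U
    ρ²*weighted≤B*U = begin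
      ρ * ρ * weightedRest x s                                       ≡⟨ sym (sumℕ-*ˡ N (ρ * ρ) _) ⟩
      sumℕ N (λ i → ρ * ρ * (∣ b i ∣ * ((N ∸ i) * ∣ x (s + i) ∣)))  ≡⟨ sumℕ-cong N (λ i _ → x∙yz≈y∙xz (ρ * ρ) ∣ b i ∣ _) ⟩
      sumℕ N (λ i → ∣ b i ∣ * (ρ * ρ * ((N ∸ i) * ∣ x (s + i) ∣)))  ≤⟨ sumℕ-mono-≤ N (λ i i<N → ℕₚ.*-monoʳ-≤ ∣ b i ∣ (term i i<N)) ⟩
      sumℕ N (λ i → ∣ b i ∣ * U)                                     ≡⟨ sumℕ-*ʳ N (∣_∣ ∘ b) U ⟩
      B * U                                                          ∎

  -- The wedge of a new pair is a b-combination of older wedges, each controlled by telescoping;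
  -- the growth of x then halves the relative size.
  wedge-step : ∀ {x y} → Solution x → Solution y → ∀ {T} → Grows x T → ∀ D k s → T ≤ s →
               (∀ i → i < N → WedgeBound x y D k (s + i)) → WedgeBound x y D (suc k) (s + N)
  wedge-step {x} {y} solx soly {T} grows D k s T≤s bounds = begin
    2 * K * ∣ wedge x y (s + N) (suc (s + N)) ∣
      ≡⟨ ℕₚ.*-assoc 2 K _ ⟩
    2 * (K * ∣ wedge x y (s + N) (suc (s + N)) ∣)
      ≡⟨ cong (λ w → 2 * (K * ∣ w ∣)) (wedge-next solx soly s) ⟩
    2 * (K * ∣ sumℤ N (λ i → b i ℤ.* wedge x y (s + i) (s + N)) ∣)
      ≤⟨ ℕₚ.*-monoʳ-≤ 2 (ℕₚ.*-monoʳ-≤ K (∣sumℤ∣≤sumℕ∣∣ N _)) ⟩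
    2 * (K * sumℕ N (λ i → ∣ b i ℤ.* wedge x y (s + i) (s + N) ∣))
      ≡⟨ cong (2 *_) (sym (sumℕ-*ˡ N K _)) ⟩
    2 * sumℕ N (λ i → K * ∣ b i ℤ.* wedge x y (s + i) (s + N) ∣)
      ≡⟨ cong (2 *_) (sumℕ-cong N (λ i _ → trans (cong (K *_) (ℤₚ.abs-* (b i) _)) (x∙yz≈y∙xz K ∣ b i ∣ _))) ⟩
    2 * sumℕ N (λ i → ∣ b i ∣ * (K * ∣ wedge x y (s + i) (s + N) ∣))
      ≤⟨ ℕₚ.*-monoʳ-≤ 2 (sumℕ-mono-≤ N (λ i i<N → ℕₚ.*-monoʳ-≤ ∣ b i ∣ (term i i<N))) ⟩
    2 * sumℕ N (λ i → ∣ b i ∣ * ((N ∸ i) * D * (∣ x (s + i) ∣ * X)))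
      ≡⟨ cong (2 *_) (sumℕ-cong N (λ i _ → regroup (∣ b i ∣) (N ∸ i) D (∣ x (s + i) ∣) X)) ⟩
    2 * sumℕ N (λ i → D * X * (∣ b i ∣ * ((N ∸ i) * ∣ x (s + i) ∣)))
      ≡⟨ cong (2 *_) (sumℕ-*ˡ N (D * X) _) ⟩
    2 * (D * X * weightedRest x s)
      ≡⟨ x∙yz≈y∙xz 2 (D * X) _ ⟩
    D * X * (2 * weightedRest x s)
      ≤⟨ ℕₚ.*-monoʳ-≤ (D * X) (2*weightedRest≤next grows s T≤s) ⟩
    D * X * ∣ x (suc (s + N)) ∣
      ≡⟨ ℕₚ.*-assoc D X _ ⟩
    D * (X * ∣ x (suc (s + N)) ∣)
      ∎
    where
    open ℕₚ.≤-Reasoning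
    K = 2 ^ k
    X = ∣ x (s + N) ∣
    regroup : ∀ bi j D xi X → bi * (j * D * (xi * X)) ≡ D * X * (bi * (j * xi))
    regroup = solve-∀
    term : ∀ i → i < N → K * ∣ wedge x y (s + i) (s + N) ∣ ≤ (N ∸ i) * D * (∣ x (s + i) ∣ * X)
    term i i<N =
      subst (λ t → K * ∣ wedge x y (s + i) t ∣ ≤ (N ∸ i) * D * (∣ x (s + i) ∣ * ∣ x t ∣))
        (m+n+[o∸n]≡m+o s (ℕₚ.<⇒≤ i<N))
        (wedge-telescope x y D k T (λ t → proj₁ ∘ grows t) (N ∸ i) (s + i) (ℕₚ.≤-trans T≤s (ℕₚ.m≤m+n s i))
          (λ r r<N-i → subst (WedgeBound x y D k) (sym (ℕₚ.+-assoc s i r)) (bounds (i + r) (i+r<N r r<N-i))))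
      where
      i+r<N : ∀ r → r < N ∸ i → i + r < N
      i+r<N r r<N-i = ℕₚ.<-≤-trans (ℕₚ.+-monoʳ-< i r<N-i) (ℕₚ.≤-reflexive (ℕₚ.m+[n∸m]≡n (ℕₚ.<⇒≤ i<N)))

  module Comparison {x y : ℕ → ℤ} (solx : Solution x) (soly : Solution y) {T : ℕ} (grows : Grows x T) where

    D : ℕ
    D = sumℕ N (λ i → ∣ wedge x y (T + i) (suc (T + i)) ∣)

    1≤∣x∣ : ∀ t → T ≤ t → 1 ≤ ∣ x t ∣
    1≤∣x∣ t T≤t = i≢0⇒∣i∣≥1 (proj₁ (grows t T≤t))

    initial : ∀ i → i < N → WedgeBound x y D 0 (T + i)
    initial i i<N = begin
      1 * ∣ wedge x y (T + i) (suc (T + i)) ∣   ≡⟨ ℕₚ.*-identityˡ _ ⟩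
      ∣ wedge x y (T + i) (suc (T + i)) ∣       ≤⟨ term≤sumℕ N (λ i → ∣ wedge x y (T + i) (suc (T + i)) ∣) i<N ⟩
      D                                         ≡⟨ sym (ℕₚ.*-identityʳ D) ⟩
      D * 1                                     ≤⟨ ℕₚ.*-monoʳ-≤ D (ℕₚ.*-mono-≤ (1≤∣x∣ (T + i) T≤T+i) (1≤∣x∣ (suc (T + i)) (ℕₚ.≤-trans T≤T+i (ℕₚ.n≤1+n _)))) ⟩
      D * (∣ x (T + i) ∣ * ∣ x (suc (T + i)) ∣) ∎
      where
      open ℕₚ.≤-Reasoning
      T≤T+i = ℕₚ.m≤m+n T i

    -- Past the first window, level 0 follows from level 1, which the step derives from earlier level-0 bounds.
    wedgeBound₀ : ∀ s → T ≤ s → WedgeBound x y D 0 s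
    wedgeBound₀ = <-rec (λ s → T ≤ s → WedgeBound x y D 0 s) bound
      where
      bound : ∀ s → (∀ {s'} → s' < s → T ≤ s' → WedgeBound x y D 0 s') → T ≤ s → WedgeBound x y D 0 s
      bound s earlier T≤s with s ∸ T ℕ.<? N
      ... | yes s-T<N = subst (WedgeBound x y D 0) (trans (ℕₚ.+-comm T (s ∸ T)) (ℕₚ.m∸n+n≡m T≤s)) (initial (s ∸ T) s-T<N)
      ... | no  s-T≮N = subst (WedgeBound x y D 0) s-N+N≡s (WedgeBound-weaken {x} {y} {D} {0} (wedge-step solx soly grows D 0 (s ∸ N) T≤s-N
                          (λ i i<N → earlier (ℕₚ.<-≤-trans (ℕₚ.+-monoʳ-< (s ∸ N) i<N) (ℕₚ.≤-reflexive s-N+N≡s))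
                                             (ℕₚ.≤-trans T≤s-N (ℕₚ.m≤m+n _ i)))))
        where
        N≤s-T : N ≤ s ∸ T
        N≤s-T = ℕₚ.≮⇒≥ s-T≮N
        s-N+N≡s : s ∸ N + N ≡ s
        s-N+N≡s = ℕₚ.m∸n+n≡m (ℕₚ.≤-trans N≤s-T (ℕₚ.m∸n≤m s T))
        T≤s-N : T ≤ s ∸ N
        T≤s-N = ℕₚ.+-cancelʳ-≤ N T (s ∸ N)
                  (ℕₚ.≤-trans (ℕₚ.+-monoʳ-≤ T N≤s-T) (ℕₚ.≤-trans (ℕₚ.≤-reflexive (ℕₚ.m+[n∸m]≡n T≤s)) (ℕₚ.≤-reflexive (sym s-N+N≡s))))

    wedgeBound : ∀ k s → T + k * N ≤ s → WedgeBound x y D k s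
    wedgeBound zero    s T+0≤s    = wedgeBound₀ s (ℕₚ.≤-trans (ℕₚ.m≤m+n T 0) T+0≤s)
    wedgeBound (suc k) s T+kN+N≤s =
      from-shifted {WedgeBound x y D (suc k)} N (T + k * N) step s (ℕₚ.≤-trans (ℕₚ.≤-reflexive regroup) T+kN+N≤s)
      where
      regroup : T + k * N + N ≡ T + suc k * N
      regroup = trans (ℕₚ.+-assoc T (k * N) N) (cong (T +_) (ℕₚ.+-comm (k * N) N))
      step : ∀ s → T + k * N ≤ s → WedgeBound x y D (suc k) (s + N)
      step s T+kN≤s = wedge-step solx soly grows D k s (ℕₚ.≤-trans (ℕₚ.m≤m+n T (k * N)) T+kN≤s)
                        (λ i _ → wedgeBound k (s + i) (ℕₚ.≤-trans T+kN≤s (ℕₚ.m≤m+n s i)))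

    wedge-decay : ∀ k t → T + k * N ≤ t → ∀ j → 2 ^ k * ∣ wedge x y t (t + j) ∣ ≤ j * D * (∣ x t ∣ * ∣ x (t + j) ∣)
    wedge-decay k t T+kN≤t j =
      wedge-telescope x y D k T (λ t → proj₁ ∘ grows t) j t (ℕₚ.≤-trans (ℕₚ.m≤m+n T (k * N)) T+kN≤t)
        (λ r _ → wedgeBound k (t + r) (ℕₚ.≤-trans T+kN≤t (ℕₚ.m≤m+n t r)))

    M : ℕ → ℕ
    M j = N * D * (∣ x T ∣ * ∣ x (T + j) ∣)

    -- Over the blocks of N steps after T the wedge bounds form a geometric series; for k = j this gives
    -- |wedge x y T (T + j)| ≤ 2 M j.
    wedge-from-T : ∀ k j → j ≤ k * N → 2 ^ k * ∣ wedge x y T (T + j) ∣ + 2 * M j ≤ 2 ^ suc k * M j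
    wedge-from-T zero zero _ rewrite ℕₚ.+-identityʳ T | wedge-self x y T = ℕₚ.≤-reflexive (double (N * D * (∣ x T ∣ * ∣ x T ∣)))
      where
      double : ∀ m → 1 * 0 + 2 * m ≡ 2 * 1 * m
      double = solve-∀
    wedge-from-T (suc k) j j≤[1+k]N with j ℕ.≤? k * N
    ... | yes j≤kN = begin
      2 * 2 ^ k * W + 2 * M j           ≤⟨ ℕₚ.+-monoʳ-≤ (2 * 2 ^ k * W) (ℕₚ.*-monoˡ-≤ (M j) (s≤s (s≤s (z≤n {2})))) ⟩
      2 * 2 ^ k * W + 4 * M j           ≡⟨ regroup (2 ^ k) W (M j) ⟩
      2 * (2 ^ k * W + 2 * M j)         ≤⟨ ℕₚ.*-monoʳ-≤ 2 (wedge-from-T k j j≤kN) ⟩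
      2 * (2 ^ suc k * M j)             ≡⟨ sym (ℕₚ.*-assoc 2 (2 ^ suc k) (M j)) ⟩
      2 ^ suc (suc k) * M j             ∎
      where
      open ℕₚ.≤-Reasoning
      W = ∣ wedge x y T (T + j) ∣
      regroup : ∀ K a m → 2 * K * a + 4 * m ≡ 2 * (K * a + 2 * m)
      regroup = solve-∀
    ... | no j≰kN = ℕₚ.*-cancelˡ-≤ Xu {{ℕ.>-nonZero (1≤∣x∣ u (ℕₚ.m≤m+n T (k * N)))}} (begin
      Xu * (Z + 2 * M j)                                          ≡⟨ ℕₚ.*-distribˡ-+ Xu Z (2 * M j) ⟩
      Xu * Z + Xu * (2 * M j)                                     ≤⟨ ℕₚ.+-monoˡ-≤ (Xu * (2 * M j)) plücker ⟩
      2 * XTj * Pv + 2 * XT * Qv + Xu * (2 * M j)                 ≤⟨ ℕₚ.+-monoˡ-≤ (Xu * (2 * M j)) (ℕₚ.+-monoʳ-≤ (2 * XTj * Pv) (ℕₚ.*-monoʳ-≤ (2 * XT) second)) ⟩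
      2 * XTj * Pv + 2 * XT * (N * D * (Xu * XTj)) + Xu * (2 * M j) ≡⟨ collect XTj Pv XT N D Xu ⟩
      2 * XTj * (Pv + 2 * (N * D * (XT * Xu)))                    ≤⟨ ℕₚ.*-monoʳ-≤ (2 * XTj) first ⟩
      2 * XTj * (2 ^ suc k * (N * D * (XT * Xu)))                 ≡⟨ rearrange XTj (2 ^ suc k) N D XT Xu ⟩
      Xu * (2 ^ suc (suc k) * M j)                                ∎)
      where
      open ℕₚ.≤-Reasoning
      K = 2 ^ k
      u = T + k * N
      kN<j : k * N < j
      kN<j = ℕₚ.≰⇒> j≰kN
      r = j ∸ k * N
      u+r≡T+j : u + r ≡ T + j
      u+r≡T+j = m+n+[o∸n]≡m+o T (ℕₚ.<⇒≤ kN<j)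
      r≤N : r ≤ N
      r≤N = ℕₚ.+-cancelˡ-≤ (k * N) r N
              (ℕₚ.≤-trans (ℕₚ.≤-reflexive (ℕₚ.m+[n∸m]≡n (ℕₚ.<⇒≤ kN<j))) (ℕₚ.≤-trans j≤[1+k]N (ℕₚ.≤-reflexive (ℕₚ.+-comm N (k * N)))))
      XT = ∣ x T ∣
      Xu = ∣ x u ∣
      XTj = ∣ x (T + j) ∣
      Pv = K * ∣ wedge x y T u ∣
      Qv = K * ∣ wedge x y u (T + j) ∣
      Z = 2 ^ suc k * ∣ wedge x y T (T + j) ∣
      plücker : Xu * Z ≤ 2 * XTj * Pv + 2 * XT * Qv
      plücker = begin
        Xu * Z                                                    ≡⟨ x∙yz≈y∙xz Xu (2 * K) _ ⟩
        2 * K * (Xu * ∣ wedge x y T (T + j) ∣)                    ≤⟨ ℕₚ.*-monoʳ-≤ (2 * K) (∣wedge∣-plücker x y T u (T + j)) ⟩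
        2 * K * (XTj * ∣ wedge x y T u ∣ + XT * ∣ wedge x y u (T + j) ∣) ≡⟨ distribute K XTj _ XT _ ⟩
        2 * XTj * Pv + 2 * XT * Qv                                ∎
        where
        distribute : ∀ K XTj a XT c → 2 * K * (XTj * a + XT * c) ≡ 2 * XTj * (K * a) + 2 * XT * (K * c)
        distribute = solve-∀
      first : Pv + 2 * (N * D * (XT * Xu)) ≤ 2 ^ suc k * (N * D * (XT * Xu))
      first = wedge-from-T k (k * N) ℕₚ.≤-refl
      second : Qv ≤ N * D * (Xu * XTj)
      second = ℕₚ.≤-trans (subst (λ t → K * ∣ wedge x y u t ∣ ≤ r * D * (Xu * ∣ x t ∣)) u+r≡T+j
                             (wedge-decay k u ℕₚ.≤-refl r))
                          (ℕₚ.*-monoˡ-≤ (Xu * XTj) (ℕₚ.*-monoˡ-≤ D r≤N))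
      collect : ∀ XTj Pv XT N D Xu → 2 * XTj * Pv + 2 * XT * (N * D * (Xu * XTj)) + Xu * (2 * (N * D * (XT * XTj)))
                                     ≡ 2 * XTj * (Pv + 2 * (N * D * (XT * Xu)))
      collect = solve-∀
      rearrange : ∀ XTj K2 N D XT Xu → 2 * XTj * (K2 * (N * D * (XT * Xu))) ≡ Xu * (2 * K2 * (N * D * (XT * XTj)))
      rearrange = solve-∀

    ratio : ℕ
    ratio = ∣ y T ∣ + 2 * (N * D * ∣ x T ∣)

    ∣y∣≤ratio*∣x∣ : 1 ≤ N → ∀ t → T ≤ t → ∣ y t ∣ ≤ ratio * ∣ x t ∣
    ∣y∣≤ratio*∣x∣ 1≤N t T≤t = subst (λ t → ∣ y t ∣ ≤ ratio * ∣ x t ∣) (ℕₚ.m+[n∸m]≡n T≤t) (after (t ∸ T))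
      where
      after : ∀ j → ∣ y (T + j) ∣ ≤ ratio * ∣ x (T + j) ∣
      after j = begin
        ∣ y (T + j) ∣                                  ≤⟨ ℕₚ.m≤m*n _ ∣ x T ∣ {{ℕ.>-nonZero (1≤∣x∣ T ℕₚ.≤-refl)}} ⟩
        ∣ y (T + j) ∣ * ∣ x T ∣                        ≡⟨ sym (ℤₚ.abs-* (y (T + j)) (x T)) ⟩
        ∣ y (T + j) ℤ.* x T ∣                          ≡⟨ cong ∣_∣ (split (x (T + j)) (y T) (y (T + j)) (x T)) ⟩
        ∣ x (T + j) ℤ.* y T ℤ.- wedge x y T (T + j) ∣  ≤⟨ ℤₚ.∣i-j∣≤∣i∣+∣j∣ (x (T + j) ℤ.* y T) (wedge x y T (T + j)) ⟩
        ∣ x (T + j) ℤ.* y T ∣ + ∣ wedge x y T (T + j) ∣ ≤⟨ ℕₚ.+-mono-≤ (ℕₚ.≤-reflexive (ℤₚ.abs-* (x (T + j)) (y T))) wedge≤2M ⟩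
        ∣ x (T + j) ∣ * ∣ y T ∣ + 2 * M j              ≡⟨ collect (∣ x (T + j) ∣) (∣ y T ∣) N D (∣ x T ∣) ⟩
        ratio * ∣ x (T + j) ∣                          ∎
        where
        open ℕₚ.≤-Reasoning
        split : ∀ xt yT yt xT → yt ℤ.* xT ≡ xt ℤ.* yT ℤ.- (xt ℤ.* yT ℤ.- yt ℤ.* xT)
        split xt yT yt xT = solve (xt ∷ yT ∷ yt ∷ xT ∷ [])
        collect : ∀ xt yT N D XT → xt * yT + 2 * (N * D * (XT * xt)) ≡ (yT + 2 * (N * D * XT)) * xt
        collect = solve-∀
        j≤jN : j ≤ j * N
        j≤jN = ℕₚ.≤-trans (ℕₚ.≤-reflexive (sym (ℕₚ.*-identityʳ j))) (ℕₚ.*-monoʳ-≤ j 1≤N)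
        wedge≤2M : ∣ wedge x y T (T + j) ∣ ≤ 2 * M j
        wedge≤2M = ℕₚ.*-cancelˡ-≤ (2 ^ j) {{ℕ.>-nonZero (ℕₚ.m^n>0 2 j)}}
          (ℕₚ.≤-trans (ℕₚ.m≤m+n _ (2 * M j))
            (ℕₚ.≤-trans (wedge-from-T j j j≤jN) (ℕₚ.≤-reflexive (reassoc (2 ^ j) (M j)))))
          where
          reassoc : ∀ K m → 2 * K * m ≡ K * (2 * m)
          reassoc = solve-∀

  -- Far out, d_t (P c)_t = (P z)_t with z = d_t c - c_t d a row of wedges of (c, d), so 2^C d_t e_t ≤ W D c_t²;
  -- comparison with c gives c_t² ≤ K₁ K₂ d_t e_t, so C = W D K₁ K₂ satisfies 2^C ≤ C.
  annihilator-kills-growth : 1 ≤ N → ∀ {c d T} (P : Poly) → Solution c → Solution d → Solution (act P c) →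
                             Grows c T → Grows d T → Grows (act P c) T → (∀ t → act P d t ≡ 0ℤ) → ⊥
  annihilator-kills-growth 1≤N {c} {d} {T} P solc sold sole growc growd growe Pd≡0 =
    ℕₚ.<-irrefl refl (ℕₚ.<-≤-trans (n<m^n (s≤s (s≤s z≤n)) C) 2^C≤C)
    where
    e = act P c
    module CD = Comparison solc sold growc
    module DC = Comparison sold solc growd
    module EC = Comparison sole solc growe
    D = CD.D
    K₁ = DC.ratio
    K₂ = EC.ratio
    W = absSum P (λ i → i * Λ ^ i)
    C = W * D * (K₁ * K₂)
    t = T + C * N
    T≤t : T ≤ t
    T≤t = ℕₚ.m≤m+n T (C * N)
    ct = ∣ c t ∣
    dt = ∣ d t ∣
    et = ∣ e t ∣
    z : ℕ → ℤ
    z s = d t ℤ.* c s ℤ.- c t ℤ.* d s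
    dₜeₜ≡Pz : d t ℤ.* e t ≡ act P z t
    dₜeₜ≡Pz = begin
      d t ℤ.* e t                              ≡⟨ minus-zero (d t ℤ.* e t) (c t) ⟩
      d t ℤ.* e t ℤ.- c t ℤ.* 0ℤ               ≡⟨ cong (λ w → d t ℤ.* e t ℤ.- c t ℤ.* w) (sym (Pd≡0 t)) ⟩
      d t ℤ.* e t ℤ.- c t ℤ.* act P d t        ≡⟨ act-*-* P (d t) (c t) c d t ⟩
      act P z t                                ∎
      where
      open ≡-Reasoning
      minus-zero : ∀ a u → a ≡ a ℤ.- u ℤ.* 0ℤ
      minus-zero a u = solve (a ∷ u ∷ [])
    2^C*∣z∣ : ∀ i → 2 ^ C * ∣ z (t + i) ∣ ≤ i * Λ ^ i * (D * (ct * ct))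
    2^C*∣z∣ i = begin
      2 ^ C * ∣ z (t + i) ∣           ≡⟨ cong (λ w → 2 ^ C * ∣ w ∣) (reorder (d t) (c (t + i)) (c t) (d (t + i))) ⟩
      2 ^ C * ∣ wedge c d t (t + i) ∣  ≤⟨ CD.wedge-decay C t ℕₚ.≤-refl i ⟩
      i * D * (ct * ∣ c (t + i) ∣)     ≤⟨ ℕₚ.*-monoʳ-≤ (i * D) (ℕₚ.*-monoʳ-≤ ct (grows-upper growc t T≤t i)) ⟩
      i * D * (ct * (Λ ^ i * ct))      ≡⟨ regroup i D ct (Λ ^ i) ⟩
      i * Λ ^ i * (D * (ct * ct))      ∎
      where
      open ℕₚ.≤-Reasoning
      reorder : ∀ dt ci ct di → dt ℤ.* ci ℤ.- ct ℤ.* di ≡ ci ℤ.* dt ℤ.- di ℤ.* ct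
      reorder dt ci ct di = solve (dt ∷ ci ∷ ct ∷ di ∷ [])
      regroup : ∀ i D c u → i * D * (c * (u * c)) ≡ i * u * (D * (c * c))
      regroup = solve-∀
    upper : 2 ^ C * (dt * et) ≤ W * (D * (ct * ct))
    upper = begin
      2 ^ C * (dt * et)                              ≡⟨ cong (2 ^ C *_) (sym (ℤₚ.abs-* (d t) (e t))) ⟩
      2 ^ C * ∣ d t ℤ.* e t ∣                        ≡⟨ cong (λ w → 2 ^ C * ∣ w ∣) dₜeₜ≡Pz ⟩
      2 ^ C * ∣ act P z t ∣                          ≤⟨ act-bound P z t (2 ^ C) (λ i → i * Λ ^ i * (D * (ct * ct))) 2^C*∣z∣ ⟩
      absSum P (λ i → i * Λ ^ i * (D * (ct * ct)))   ≡⟨ absSum-*ʳ P (λ i → i * Λ ^ i) _ ⟩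
      W * (D * (ct * ct))                            ∎
      where open ℕₚ.≤-Reasoning
    lower : ct * ct ≤ K₁ * K₂ * (dt * et)
    lower = ℕₚ.≤-trans (ℕₚ.*-mono-≤ (DC.∣y∣≤ratio*∣x∣ 1≤N t T≤t) (EC.∣y∣≤ratio*∣x∣ 1≤N t T≤t))
                       (ℕₚ.≤-reflexive (interchange K₁ dt K₂ et))
      where
      interchange : ∀ a b c d → a * b * (c * d) ≡ a * c * (b * d)
      interchange = solve-∀
    2^C≤C : 2 ^ C ≤ C
    2^C≤C = ℕₚ.*-cancelˡ-≤ (dt * et) {{ℕ.>-nonZero dₜeₜ≥1}} (begin
      dt * et * 2 ^ C                ≡⟨ ℕₚ.*-comm (dt * et) (2 ^ C) ⟩
      2 ^ C * (dt * et)              ≤⟨ upper ⟩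
      W * (D * (ct * ct))            ≤⟨ ℕₚ.*-monoʳ-≤ W (ℕₚ.*-monoʳ-≤ D lower) ⟩
      W * (D * (K₁ * K₂ * (dt * et))) ≡⟨ regroup W D (K₁ * K₂) (dt * et) ⟩
      dt * et * C                    ∎)
      where
      open ℕₚ.≤-Reasoning
      dₜeₜ≥1 : 1 ≤ dt * et
      dₜeₜ≥1 = ℕₚ.*-mono-≤ (i≢0⇒∣i∣≥1 (proj₁ (growd t T≤t))) (i≢0⇒∣i∣≥1 (proj₁ (growe t T≤t)))
      regroup : ∀ W D K p → W * (D * (K * p)) ≡ p * (W * D * K)
      regroup = solve-∀

  -- The impulse solution

  -- impulseWindow t i = impulse (t + i) for i ≤ N: carrying the whole window makes the recursion structural.
  impulseWindow : ℕ → ℕ → ℤ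
  impulseWindow zero    i with i ℕ.≟ N
  ... | yes _ = 1ℤ
  ... | no  _ = 0ℤ
  impulseWindow (suc t) i with i ℕ.<? N
  ... | yes _ = impulseWindow t (suc i)
  ... | no  _ = ℤ.- (a₁ ℤ.* impulseWindow t N ℤ.+ sumℤ N (λ j → b j ℤ.* impulseWindow t j))

  impulse : ℕ → ℤ
  impulse t = impulseWindow t 0

  impulseWindow-shift : ∀ t i → i < N → impulseWindow (suc t) i ≡ impulseWindow t (suc i)
  impulseWindow-shift t i i<N with i ℕ.<? N
  ... | yes _   = refl
  ... | no  i≮N = ⊥-elim (i≮N i<N)

  impulseWindow-last : ∀ t → impulseWindow (suc t) N ≡ ℤ.- (a₁ ℤ.* impulseWindow t N ℤ.+ sumℤ N (λ j → b j ℤ.* impulseWindow t j))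
  impulseWindow-last t with N ℕ.<? N
  ... | yes N<N = ⊥-elim (ℕₚ.<-irrefl refl N<N)
  ... | no  _   = refl

  impulseWindow≡impulse : ∀ i t → i ≤ N → impulseWindow t i ≡ impulse (t + i)
  impulseWindow≡impulse zero    t _   rewrite ℕₚ.+-identityʳ t = refl
  impulseWindow≡impulse (suc i) t i<N =
    trans (sym (impulseWindow-shift t i i<N))
          (trans (impulseWindow≡impulse i (suc t) (ℕₚ.<⇒≤ i<N)) (cong impulse (sym (ℕₚ.+-suc t i))))

  impulse-solution : Solution impulse
  impulse-solution = solution λ s → begin
    impulse (suc (s + N))                                                  ≡⟨ sym (impulseWindow≡impulse N (suc s) ℕₚ.≤-refl) ⟩
    impulseWindow (suc s) N                                                ≡⟨ impulseWindow-last s ⟩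
    ℤ.- (a₁ ℤ.* impulseWindow s N ℤ.+ sumℤ N (λ j → b j ℤ.* impulseWindow s j)) ≡⟨ cong₂ (λ u v → ℤ.- (a₁ ℤ.* u ℤ.+ v))
                                                                                   (impulseWindow≡impulse N s ℕₚ.≤-refl)
                                                                                   (sumℤ-cong N (λ j j<N → cong (b j ℤ.*_) (impulseWindow≡impulse j s (ℕₚ.<⇒≤ j<N)))) ⟩
    ℤ.- (a₁ ℤ.* impulse (s + N) ℤ.+ rest impulse s)                        ∎
    where open ≡-Reasoning

  impulse-initial : ∀ i → i < N → impulse i ≡ 0ℤ
  impulse-initial i i<N with i ℕ.≟ N | impulseWindow≡impulse i 0 (ℕₚ.<⇒≤ i<N)
  ... | yes refl | _  = ⊥-elim (ℕₚ.<-irrefl refl i<N)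
  ... | no  _    | eq = sym eq

  impulse-N : impulse N ≡ 1ℤ
  impulse-N with N ℕ.≟ N | impulseWindow≡impulse N 0 ℕₚ.≤-refl
  ... | yes _   | eq = sym eq
  ... | no  N≢N | _  = ⊥-elim (N≢N refl)

  impulse-leads : Leads 1 impulse 0
  impulse-leads = (λ eq → 1≢0 (trans (sym impulse-N) eq)) , older≤
    where
    1≢0 : 1ℤ ≢ 0ℤ
    1≢0 ()
    older≤ : ∀ i → i < N → 1 * ∣ impulse (0 + i) ∣ ≤ ∣ impulse (0 + N) ∣
    older≤ i i<N rewrite impulse-initial i i<N = z≤n

  act-impulse : ∀ q l → Degree≤ q l → l ≤ N → act q impulse (N ∸ l) ≡ coeff q l
  act-impulse q l deg l≤N = begin
    act q impulse (N ∸ l)                ≡⟨ act-lead q l impulse (N ∸ l) deg (λ i i<l → impulse-initial (N ∸ l + i) (below i i<l)) ⟩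
    coeff q l ℤ.* impulse (N ∸ l + l)    ≡⟨ cong (λ t → coeff q l ℤ.* impulse t) (ℕₚ.m∸n+n≡m l≤N) ⟩
    coeff q l ℤ.* impulse N              ≡⟨ cong (coeff q l ℤ.*_) impulse-N ⟩
    coeff q l ℤ.* 1ℤ                     ≡⟨ ℤₚ.*-identityʳ (coeff q l) ⟩
    coeff q l                            ∎
    where
    open ≡-Reasoning
    below : ∀ i → i < l → N ∸ l + i < N
    below i i<l = ℕₚ.<-≤-trans (ℕₚ.+-monoʳ-< (N ∸ l) i<l) (ℕₚ.≤-reflexive (ℕₚ.m∸n+n≡m l≤N))

-- The rescaled polynomial and its recurrence

module Perron (N : ℕ) (a : ℕ → ℤ) where

  A : ℤ
  A = a (suc N)

  b : ℕ → ℤ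
  b i = a i ℤ.* A ℤ.^ (N ∸ i)

  -- F has coefficients A bᵢ (i < N), A a_N, A: it is A times the monic integer polynomial Aᴺ f (z / A).
  F : Poly
  F = rescale A (suc N) (polyOf (suc N) a)

  act-F : ∀ x s → act F x s ≡ A ℤ.* (x (suc (s + N)) ℤ.+ (a N ℤ.* x (s + N) ℤ.+ sumℤ N (λ i → b i ℤ.* x (s + i))))
  act-F x s = begin
    act F x s                                     ≡⟨ cong (λ p → act (rescale A (suc N) p) x s) (polyOf≡applyUpTo (suc N) a) ⟩
    act (rescale A (suc N) (applyUpTo a (suc (suc N)))) x s ≡⟨ act-rescale-applyUpTo A (suc N) a (suc (suc N)) x s ⟩
    sumℤ (suc (suc N)) g                          ≡⟨ sumℤ-snoc (suc N) g ⟩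
    sumℤ (suc N) g ℤ.+ g (suc N)                  ≡⟨ cong (ℤ._+ g (suc N)) (sumℤ-snoc N g) ⟩
    sumℤ N g ℤ.+ g N ℤ.+ g (suc N)                ≡⟨ cong₂ ℤ._+_ (cong₂ ℤ._+_ older newest) next ⟩
    A ℤ.* S ℤ.+ A ℤ.* (a N ℤ.* x (s + N)) ℤ.+ A ℤ.* x (suc (s + N)) ≡⟨ factor A S (a N ℤ.* x (s + N)) (x (suc (s + N))) ⟩
    A ℤ.* (x (suc (s + N)) ℤ.+ (a N ℤ.* x (s + N) ℤ.+ S)) ∎
    where
    open ≡-Reasoning
    g : ℕ → ℤ
    g i = a i ℤ.* A ℤ.^ (suc N ∸ i) ℤ.* x (s + i)
    S = sumℤ N (λ i → b i ℤ.* x (s + i))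
    reassoc : ∀ u A P v → u ℤ.* (A ℤ.* P) ℤ.* v ≡ A ℤ.* (u ℤ.* P ℤ.* v)
    reassoc u A P v = solve (u ∷ A ∷ P ∷ v ∷ [])
    older : sumℤ N g ≡ A ℤ.* S
    older = trans (sumℤ-cong N (λ i i<N → trans (cong (λ k → a i ℤ.* A ℤ.^ k ℤ.* x (s + i)) (ℕₚ.+-∸-assoc 1 (ℕₚ.<⇒≤ i<N)))
                                                 (reassoc (a i) A (A ℤ.^ (N ∸ i)) (x (s + i)))))
                  (sumℤ-*ˡ N A _)
    newest : g N ≡ A ℤ.* (a N ℤ.* x (s + N))
    newest = trans (cong (λ k → a N ℤ.* A ℤ.^ k ℤ.* x (s + N)) (trans (ℕₚ.+-∸-assoc 1 (ℕₚ.≤-refl {N})) (cong suc (ℕₚ.n∸n≡0 N))))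
                   (trans (reassoc (a N) A 1ℤ (x (s + N))) (cong (A ℤ.*_) (cong (ℤ._* x (s + N)) (ℤₚ.*-identityʳ (a N)))))
    next : g (suc N) ≡ A ℤ.* x (suc (s + N))
    next = trans (cong₂ (λ k t → A ℤ.* A ℤ.^ k ℤ.* x t) (ℕₚ.n∸n≡0 N) (ℕₚ.+-suc s N))
                 (cong (ℤ._* x (suc (s + N))) (ℤₚ.*-identityʳ A))
    factor : ∀ A S p q → A ℤ.* S ℤ.+ A ℤ.* p ℤ.+ A ℤ.* q ≡ A ℤ.* (q ℤ.+ (p ℤ.+ S))
    factor A S p q = solve (A ∷ S ∷ p ∷ q ∷ [])

  boundSum≡sumℕ∣b∣ : boundSum (suc N) a ≡ sumℕ N (∣_∣ ∘ b)
  boundSum≡sumℕ∣b∣ = trans (cong sum (Listₚ.map-upTo _ N))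
    (sumℕ-cong N (λ i _ → sym (trans (ℤₚ.abs-* (a i) (A ℤ.^ (N ∸ i))) (cong (∣ a i ∣ *_) (∣i∣^n A (N ∸ i))))))

module PerronFactorisation (N : ℕ) (a : ℕ → ℤ) (1≤N : 1 ≤ N) (A≢0 : a (suc N) ≢ 0ℤ)
                           (gap : suc (boundSum (suc N) a) < ∣ a N ∣) where

  open Perron N a

  gap′ : sumℕ N (∣_∣ ∘ b) + 2 ≤ ∣ a N ∣
  gap′ = ℕₚ.≤-trans (ℕₚ.≤-reflexive (trans (ℕₚ.+-comm _ 2) (cong (suc ∘ suc) (sym boundSum≡sumℕ∣b∣)))) gap

  open Recurrence N (a N) b gap′

  annihilated-by-F⇒solution : ∀ {x} → (∀ t → act F x t ≡ 0ℤ) → Solution x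
  annihilated-by-F⇒solution {x} Fx≡0 = solution λ s →
    inverseˡ-unique (x (suc (s + N))) _
      ([ (λ A≡0 → ⊥-elim (A≢0 A≡0)) , (λ eq → eq) ]′ (ℤₚ.i*j≡0⇒i≡0∨j≡0 A (trans (sym (act-F x s)) (Fx≡0 s))))

  solution⇒annihilated-by-F : ∀ {x} → Solution x → ∀ t → act F x t ≡ 0ℤ
  solution⇒annihilated-by-F {x} sol t = begin
    act F x t                                                        ≡⟨ act-F x t ⟩
    A ℤ.* (x (suc (t + N)) ℤ.+ v)                                    ≡⟨ cong (λ u → A ℤ.* (u ℤ.+ v)) (recurrence sol t) ⟩
    A ℤ.* (ℤ.- v ℤ.+ v)                                              ≡⟨ cong (A ℤ.*_) (ℤₚ.+-inverseˡ v) ⟩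
    A ℤ.* 0ℤ                                                         ≡⟨ ℤₚ.*-zeroʳ A ⟩
    0ℤ                                                               ∎
    where
    open ≡-Reasoning
    v = a N ℤ.* x (t + N) ℤ.+ rest x t

  -- Polynomials in the shift operator commute, so they map solutions to solutions.
  act-solution : ∀ p {x} → Solution x → Solution (act p x)
  act-solution p {x} sol = annihilated-by-F⇒solution λ t →
    trans (act-comm F p x t) (act-zero p (act F x) t (λ i → solution⇒annihilated-by-F sol (t + i)))

  act-impulse-¬¬leads : ∀ p q l → (∀ t → act p (act q impulse) t ≡ 0ℤ) → coeff p 0 ≢ 0ℤ → HasDegree q l → l ≤ N →
                        ¬ (∀ s → ¬ Leads 1 (act q impulse) s)
  act-impulse-¬¬leads p q l pd≡0 p₀≢0 (deg , qₗ≢0) l≤N ¬leads =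
    qₗ≢0 (trans (sym (act-impulse q l deg l≤N)) (annihilated∧eventually-zero⇒zero p p₀≢0 pd≡0 T late (N ∸ l)))
    where
    eventually = ¬leads⇒eventually-zero (act-solution q impulse-solution) ¬leads
    T = proj₁ eventually
    late = proj₂ eventually

  F-no-factorisation : ∀ p q k l → (∀ x t → act p (act q x) t ≡ act F x t) → coeff p 0 ≢ 0ℤ → coeff q 0 ≢ 0ℤ →
                       HasDegree p k → HasDegree q l → k ≤ N → l ≤ N → ⊥
  F-no-factorisation p q k l pq≡F p₀≢0 q₀≢0 degp degq k≤N l≤N =
    act-impulse-¬¬leads p q l pd≡0 p₀≢0 degq l≤N λ s leads-d →
    act-impulse-¬¬leads q p k qe≡0 q₀≢0 degp k≤N λ s' leads-e →
    common-growth (leads⇒grows impulse-solution {0} impulse-leads) (leads⇒grows sold {s} leads-d)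
                  (leads⇒grows sole {s'} leads-e)
    where
    d = act q impulse
    sold = act-solution q impulse-solution
    sole = act-solution p impulse-solution
    pd≡0 : ∀ t → act p d t ≡ 0ℤ
    pd≡0 t = trans (pq≡F impulse t) (solution⇒annihilated-by-F impulse-solution t)
    qe≡0 : ∀ t → act q (act p impulse) t ≡ 0ℤ
    qe≡0 t = trans (act-comm q p impulse t) (pd≡0 t)
    common-growth : ∀ {T₀ T₁ T₂} → Grows impulse T₀ → Grows d T₁ → Grows (act p impulse) T₂ → ⊥
    common-growth {T₀} {T₁} {T₂} g₀ g₁ g₂ = annihilator-kills-growth 1≤N {T = T₀ ⊔ T₁ ⊔ T₂} p impulse-solution sold sole
      (grows-mono (ℕₚ.≤-trans (ℕₚ.m≤m⊔n T₀ T₁) (ℕₚ.m≤m⊔n _ T₂)) g₀)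
      (grows-mono (ℕₚ.≤-trans (ℕₚ.m≤n⊔m T₀ T₁) (ℕₚ.m≤m⊔n _ T₂)) g₁)
      (grows-mono (ℕₚ.m≤n⊔m (T₀ ⊔ T₁) T₂) g₂)
      pd≡0

  proper-factorisation-impossible : ∀ g h k l → g *P h ≈P polyOf (suc N) a → coeff g 0 ℤ.* coeff h 0 ≢ 0ℤ →
                                    HasDegree g (suc k) → HasDegree h (suc l) → suc k + suc l ≡ suc N → ⊥
  proper-factorisation-impossible g h k l gh≈f g₀h₀≢0 (degg , gₖ≢0) (degh , hₗ≢0) k+l≡N =
    F-no-factorisation p q (suc k) (suc l) pq≡F
      (lowest g (i*j≢0⇒i≢0 {j = coeff h 0} g₀h₀≢0) (suc k)) (lowest h (i*j≢0⇒j≢0 {coeff g 0} g₀h₀≢0) (suc l))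
      (rescale-Degree≤ A (suc k) g degg , highest g (suc k) gₖ≢0)
      (rescale-Degree≤ A (suc l) h degh , highest h (suc l) hₗ≢0)
      (ℕₚ.≤-pred (ℕₚ.<-≤-trans (ℕₚ.m<m+n (suc k) (s≤s z≤n)) (ℕₚ.≤-reflexive k+l≡N)))
      (ℕₚ.≤-pred (ℕₚ.<-≤-trans (ℕₚ.m<n+m (suc l) (s≤s z≤n)) (ℕₚ.≤-reflexive k+l≡N)))
    where
    p = rescale A (suc k) g
    q = rescale A (suc l) h
    pq≡F : ∀ x t → act p (act q x) t ≡ act F x t
    pq≡F x t = begin
      act p (act q x) t                             ≡⟨ sym (act-*P p q x t) ⟩
      act (p *P q) x t
        ≡⟨ act-≈P (p *P q) (rescale A (suc k + suc l) (g *P h)) x t (rescale-*P A g h (suc k) (suc l) degg degh) ⟩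
      act (rescale A (suc k + suc l) (g *P h)) x t  ≡⟨ cong (λ e → act (rescale A e (g *P h)) x t) k+l≡N ⟩
      act (rescale A (suc N) (g *P h)) x t
        ≡⟨ act-≈P (rescale A (suc N) (g *P h)) F x t (rescale-≈P A (suc N) (g *P h) (polyOf (suc N) a) gh≈f) ⟩
      act F x t                                     ∎
      where open ≡-Reasoning
    lowest : ∀ r → coeff r 0 ≢ 0ℤ → ∀ e → coeff (rescale A e r) 0 ≢ 0ℤ
    lowest r r₀≢0 e rescaled≡0 =
      i*j≢0 r₀≢0 (λ Aᵉ≡0 → A≢0 (ℤₚ.i^n≡0⇒i≡0 A e Aᵉ≡0)) (trans (sym (coeff-rescale A e r 0)) rescaled≡0)
    highest : ∀ r e → coeff r e ≢ 0ℤ → coeff (rescale A e r) e ≢ 0ℤ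
    highest r e rₑ≢0 rescaled≡0 = rₑ≢0 (begin
      coeff r e                         ≡⟨ sym (ℤₚ.*-identityʳ (coeff r e)) ⟩
      coeff r e ℤ.* A ℤ.^ 0             ≡⟨ cong (λ k → coeff r e ℤ.* A ℤ.^ k) (sym (ℕₚ.n∸n≡0 e)) ⟩
      coeff r e ℤ.* A ℤ.^ (e ∸ e)       ≡⟨ sym (coeff-rescale A e r e) ⟩
      coeff (rescale A e r) e           ≡⟨ rescaled≡0 ⟩
      0ℤ                                ∎)
      where open ≡-Reasoning

module _ {m : ℕ} {a : ℕ → ℤ} (prim : Primitive m a) (g h : Poly) (gh≈f : g *P h ≈P polyOf m a) where

  constant-factorˡ⇒unit : Degree≤ g 0 → IsUnit g
  constant-factorˡ⇒unit deg = constant-unit g deg (prim ∣ coeff g 0 ∣ divides-all)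
    where
    divides-all : ∀ i → i ≤ m → ∣ coeff g 0 ∣ ∣ ∣ a i ∣
    divides-all i i≤m = divides ∣ coeff h i ∣ (begin
      ∣ a i ∣                          ≡⟨ cong ∣_∣ (trans (sym (coeff-polyOf-≤ m a i i≤m)) (trans (sym (gh≈f i)) (coeff-*P-constˡ g h deg i))) ⟩
      ∣ coeff g 0 ℤ.* coeff h i ∣      ≡⟨ ℤₚ.abs-* (coeff g 0) (coeff h i) ⟩
      ∣ coeff g 0 ∣ * ∣ coeff h i ∣    ≡⟨ ℕₚ.*-comm ∣ coeff g 0 ∣ ∣ coeff h i ∣ ⟩
      ∣ coeff h i ∣ * ∣ coeff g 0 ∣    ∎)
      where open ≡-Reasoning

  constant-factorʳ⇒unit : Degree≤ h 0 → IsUnit h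
  constant-factorʳ⇒unit deg = constant-unit h deg (prim ∣ coeff h 0 ∣ divides-all)
    where
    divides-all : ∀ i → i ≤ m → ∣ coeff h 0 ∣ ∣ ∣ a i ∣
    divides-all i i≤m = divides ∣ coeff g i ∣ (begin
      ∣ a i ∣                          ≡⟨ cong ∣_∣ (trans (sym (coeff-polyOf-≤ m a i i≤m)) (trans (sym (gh≈f i)) (coeff-*P-constʳ g h deg i))) ⟩
      ∣ coeff g i ℤ.* coeff h 0 ∣      ≡⟨ ℤₚ.abs-* (coeff g i) (coeff h 0) ⟩
      ∣ coeff g i ∣ * ∣ coeff h 0 ∣    ∎)
      where open ≡-Reasoning

  factor-degrees : a m ≢ 0ℤ → ∀ {k l} → HasDegree g k → HasDegree h l → k + l ≡ m
  factor-degrees aₘ≢0 {k} {l} (degg , gₖ≢0) (degh , hₗ≢0) = ℕₚ.≤-antisym k+l≤m m≤k+l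
    where
    product = *P-Degree≤-lead {g} {h} k l degg degh
    k+l≤m : k + l ≤ m
    k+l≤m with k + l ℕ.≤? m
    ... | yes k+l≤m = k+l≤m
    ... | no  k+l≰m = ⊥-elim (i*j≢0 gₖ≢0 hₗ≢0
            (trans (sym (proj₂ product)) (trans (gh≈f (k + l)) (coeff-polyOf-> m a (k + l) (ℕₚ.≰⇒> k+l≰m)))))
    m≤k+l : m ≤ k + l
    m≤k+l with m ℕ.≤? k + l
    ... | yes m≤k+l = m≤k+l
    ... | no  m≰k+l = ⊥-elim (aₘ≢0 (trans (sym (coeff-polyOf-≤ m a m ℕₚ.≤-refl)) (trans (sym (gh≈f m)) (proj₁ product m (ℕₚ.≰⇒> m≰k+l)))))

  constant-coeffs≢0 : a 0 ≢ 0ℤ → coeff g 0 ℤ.* coeff h 0 ≢ 0ℤ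
  constant-coeffs≢0 a₀≢0 g₀h₀≡0 =
    a₀≢0 (trans (sym (coeff-polyOf-≤ m a 0 z≤n)) (trans (sym (gh≈f 0)) (trans (coeff-*P-zero g h) g₀h₀≡0)))

theoremB : (m : ℕ) (a : ℕ → ℤ) → 2 ≤ m → Primitive m a →
    ¬ (a 0 ℤ.* a m ≡ ℤ.+ 0) →
    suc (boundSum m a) < ∣ a (m ∸ 1) ∣ →
    Irreducible (polyOf m a)
theoremB m@(suc N@(suc _)) a (s≤s (s≤s z≤n)) prim a₀aₘ≢0 gap = f≉0 , f-not-unit , factors
  where
  a₀≢0 = i*j≢0⇒i≢0 {j = a m} a₀aₘ≢0
  aₘ≢0 = i*j≢0⇒j≢0 {a 0} a₀aₘ≢0
  f≉0 : ¬ polyOf m a ≈P []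
  f≉0 f≈0 = a₀≢0 (trans (sym (coeff-polyOf-≤ m a 0 z≤n)) (f≈0 0))
  f-not-unit : ¬ IsUnit (polyOf m a)
  f-not-unit unit = aₘ≢0 (trans (sym (coeff-polyOf-≤ m a m ℕₚ.≤-refl)) ([ (λ f≈1 → f≈1 m) , (λ f≈-1 → f≈-1 m) ]′ unit))
  factors : ∀ g h → g *P h ≈P polyOf m a → IsUnit g ⊎ IsUnit h
  factors g h gh≈f with ≈[]⊎HasDegree g | ≈[]⊎HasDegree h
  ... | inj₁ g≈0 | _ = ⊥-elim (f≉0 (λ i → trans (sym (gh≈f i)) (*P-zeroˡ g h g≈0 i)))
  ... | inj₂ _   | inj₁ h≈0 = ⊥-elim (f≉0 (λ i → trans (sym (gh≈f i)) (*P-zeroʳ g h h≈0 i)))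
  ... | inj₂ (zero , degg) | inj₂ _ = inj₁ (constant-factorˡ⇒unit prim g h gh≈f (proj₁ degg))
  ... | inj₂ (suc _ , _) | inj₂ (zero , degh) = inj₂ (constant-factorʳ⇒unit prim g h gh≈f (proj₁ degh))
  ... | inj₂ (suc k , degg) | inj₂ (suc l , degh) = ⊥-elim
    (PerronFactorisation.proper-factorisation-impossible N a (s≤s z≤n) aₘ≢0 gap g h k l gh≈f
      (constant-coeffs≢0 prim g h gh≈f a₀≢0) degg degh (factor-degrees prim g h gh≈f aₘ≢0 degg degh))
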